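{- Let $r\ge2$ be an integer and let $p\nmid 6$ be a prime with $p\equiv1\bmod r$. For any $\gamma\in\mathbb{F}_p^\times$, \[ |\{(a,b)\in\mathbb{F}_p^2:\Delta_{a,b}=\gamma c^r\text{ for some }c\in\mathbb{F}_p\}|=\frac{1}{r}p^2+O_r(p^{3/2}), \] where the implied constant depends only on $r$.
   Context: For $a,b$ in a field, $\Delta_{a,b}=-16(4a^3+27b^2)$. -}

module Defs where

open import Data.Nat as ℕ using (ℕ)
open import Data.Nat.Divisibility using (_∣?_)
open import Data.Integer as ℤ using (ℤ; +_; ∣_∣)
open import Data.List using (List; upTo; cartesianProduct; filter; length)
open import Data.List.Relation.Unary.Any using (Any; any?)
open import Data.Product using (_×_; _,_)
open import Relation.Nullary using (Dec)
open import Relation.Binary.PropositionalEquality using (_≡_)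

Δ : ℤ → ℤ → ℤ
Δ a b = ℤ.- (+ 16) ℤ.* ((+ 4) ℤ.* (a ℤ.^ 3) ℤ.+ (+ 27) ℤ.* (b ℤ.^ 2))

_≡[mod_]_ : ℤ → ℕ → ℤ → Set
x ≡[mod p ] y = p Data.Nat.Divisibility.∣ ∣ x ℤ.- y ∣

≡mod? : ∀ x p y → Dec (x ≡[mod p ] y)
≡mod? x p y = p ∣? ∣ x ℤ.- y ∣

-- Elements of 𝔽_p are represented by 0,…,p-1.
-- "Δ_{a,b} = γ c^r for some c ∈ 𝔽_p"
Good : (p r γ : ℕ) → ℕ × ℕ → Set
Good p r γ (a , b) = Any (λ c → Δ (+ a) (+ b) ≡[mod p ] ((+ γ) ℤ.* ((+ c) ℤ.^ r))) (upTo p)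

Good? : ∀ p r γ x → Dec (Good p r γ x)
Good? p r γ (a , b) = any? (λ c → ≡mod? (Δ (+ a) (+ b)) p ((+ γ) ℤ.* ((+ c) ℤ.^ r))) (upTo p)

count : (p r γ : ℕ) → ℕ
count p r γ = length (filter (Good? p r γ) (cartesianProduct (upTo p) (upTo p)))

-- Let N(y) be the number of (a, b) ∈ 𝔽_p² with Δ(a,b) = y, and G the set of values γc^r. Each value
-- of x ↦ γx^r is taken at most r times and every nonzero value y satisfies y^m = γ^m, m = (p-1)/r,
-- so |G| = 1 + m, and the count is Σ_{y∈G} N(y). Now Σ_y N(y) = p², while Σ_y N(y)² counts the pairs
-- with 4(a³ - a′³) = 27(b′² - b²), of which there are at most p·#{a³ = a′³} + p for each (a, a′);
-- hence Σ_y N(y)² ≤ p³ + 3p², that is Σ_y (N(y) - p)² ≤ 3p². Cauchy–Schwarz over G gives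
-- |count - (1 + m)p|² ≤ (1 + m)·3p² ≤ 3p³, and r(1 + m)p = p² + (r - 1)p then gives |r·count - p²|² ≤ 8r²p³.

module Submission where

open import Data.Nat using (ℕ; _≤_)
import Data.Nat.Divisibility as Div
open import Data.Nat.Primality using (Prime)
open import Data.Integer using (ℤ)
open import Relation.Nullary using (¬_)

module FiniteSum where

  open import Data.Nat
  open import Data.Nat.Properties
  open import Data.Nat.Tactic.RingSolver using (solve-∀)
  open import Data.Product using (_×_; _,_; proj₁; proj₂; ∃-syntax)
  open import Data.Empty using (⊥-elim)
  open import Data.Unit using (tt)
  open import Data.List using (List; []; _∷_; _++_; map; filter; length; applyUpTo; upTo; cartesianProduct)
  open import Function using (_∘_)
  open import Level using (0ℓ)
  open import Relation.Nullary using (Dec; yes; no; ¬_; ¬?)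
  open import Relation.Nullary.Decidable using (_×-dec_)
  open import Relation.Unary using (Pred; Decidable)
  open import Relation.Binary.PropositionalEquality

  ∑ : ℕ → (ℕ → ℕ) → ℕ
  ∑ zero    f = 0
  ∑ (suc n) f = f 0 + ∑ n (f ∘ suc)

  syntax ∑ n (λ i → e) = ∑[ i < n ] e

  ∑-cong : ∀ n {f g : ℕ → ℕ} → (∀ i → i < n → f i ≡ g i) → ∑ n f ≡ ∑ n g
  ∑-cong zero    eq = refl
  ∑-cong (suc n) eq = cong₂ _+_ (eq 0 z<s) (∑-cong n (λ i i<n → eq (suc i) (s<s i<n)))

  ∑-mono-≤ : ∀ n {f g : ℕ → ℕ} → (∀ i → i < n → f i ≤ g i) → ∑ n f ≤ ∑ n g
  ∑-mono-≤ zero    le = z≤n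
  ∑-mono-≤ (suc n) le = +-mono-≤ (le 0 z<s) (∑-mono-≤ n (λ i i<n → le (suc i) (s<s i<n)))

  ∑-distrib-+ : ∀ n (f g : ℕ → ℕ) → ∑[ i < n ] (f i + g i) ≡ ∑ n f + ∑ n g
  ∑-distrib-+ zero    f g = refl
  ∑-distrib-+ (suc n) f g = begin
    (f 0 + g 0) + ∑[ i < n ] (f (suc i) + g (suc i)) ≡⟨ cong (f 0 + g 0 +_) (∑-distrib-+ n (f ∘ suc) (g ∘ suc)) ⟩
    (f 0 + g 0) + (∑ n (f ∘ suc) + ∑ n (g ∘ suc))     ≡⟨ interchange (f 0) (g 0) _ _ ⟩
    (f 0 + ∑ n (f ∘ suc)) + (g 0 + ∑ n (g ∘ suc))     ∎
    where
    open ≡-Reasoning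
    interchange : ∀ a b c d → (a + b) + (c + d) ≡ (a + c) + (b + d)
    interchange = solve-∀

  *-distribˡ-∑ : ∀ n k (f : ℕ → ℕ) → k * ∑ n f ≡ ∑[ i < n ] (k * f i)
  *-distribˡ-∑ zero    k f = *-zeroʳ k
  *-distribˡ-∑ (suc n) k f = trans (*-distribˡ-+ k (f 0) _) (cong (k * f 0 +_) (*-distribˡ-∑ n k (f ∘ suc)))

  *-distribʳ-∑ : ∀ n k (f : ℕ → ℕ) → ∑ n f * k ≡ ∑[ i < n ] (f i * k)
  *-distribʳ-∑ n k f = trans (*-comm (∑ n f) k)
    (trans (*-distribˡ-∑ n k f) (∑-cong n (λ i _ → *-comm k (f i))))

  ∑-const : ∀ n k → ∑[ i < n ] k ≡ n * k
  ∑-const zero    k = refl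
  ∑-const (suc n) k = cong (k +_) (∑-const n k)

  ∑-swap : ∀ m n (f : ℕ → ℕ → ℕ) → ∑[ i < m ] ∑[ j < n ] f i j ≡ ∑[ j < n ] ∑[ i < m ] f i j
  ∑-swap zero    n f = sym (trans (∑-const n 0) (*-zeroʳ n))
  ∑-swap (suc m) n f = begin
    ∑ n (f 0) + ∑[ i < m ] ∑[ j < n ] f (suc i) j ≡⟨ cong (∑ n (f 0) +_) (∑-swap m n (f ∘ suc)) ⟩
    ∑ n (f 0) + ∑[ j < n ] ∑[ i < m ] f (suc i) j ≡⟨ ∑-distrib-+ n (f 0) _ ⟨
    ∑[ j < n ] ∑[ i < suc m ] f i j               ∎
    where open ≡-Reasoning

  ∑-pred : ∀ n .{{_ : NonZero n}} (f : ℕ → ℕ) → ∑ n f ≡ f 0 + ∑ (pred n) (f ∘ suc)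
  ∑-pred (suc n) f = refl

  χ : {A : Set} → Dec A → ℕ
  χ (yes _) = 1
  χ (no _)  = 0

  χ≤1 : {A : Set} (a? : Dec A) → χ a? ≤ 1
  χ≤1 (yes _) = s≤s z≤n
  χ≤1 (no _)  = z≤n

  χ-yes : {A : Set} (a? : Dec A) → A → χ a? ≡ 1
  χ-yes (yes _) _ = refl
  χ-yes (no ¬a) a = ⊥-elim (¬a a)

  χ-no : {A : Set} (a? : Dec A) → ¬ A → χ a? ≡ 0
  χ-no (yes a) ¬a = ⊥-elim (¬a a)
  χ-no (no _)  _  = refl

  χ-cong : {A B : Set} (a? : Dec A) (b? : Dec B) → (A → B) → (B → A) → χ a? ≡ χ b?
  χ-cong (yes _) (yes _) _   _   = refl
  χ-cong (yes a) (no ¬b) a→b _   = ⊥-elim (¬b (a→b a))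
  χ-cong (no ¬a) (yes b) _   b→a = ⊥-elim (¬a (b→a b))
  χ-cong (no _)  (no _)  _   _   = refl

  χ-mono-≤ : {A B : Set} (a? : Dec A) (b? : Dec B) → (A → B) → χ a? ≤ χ b?
  χ-mono-≤ (yes a) (yes _) _   = ≤-refl
  χ-mono-≤ (yes a) (no ¬b) a→b = ⊥-elim (¬b (a→b a))
  χ-mono-≤ (no _)  _       _   = z≤n

  ∑-χ≟ : ∀ n {y} (h : ℕ → ℕ) → y < n → ∑[ i < n ] (χ (i ≟ y) * h i) ≡ h y
  ∑-χ≟ (suc n) {zero}  h _ = begin
    (h 0 + 0) + ∑[ i < n ] 0 ≡⟨ cong₂ _+_ (+-identityʳ (h 0)) (trans (∑-const n 0) (*-zeroʳ n)) ⟩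
    h 0 + 0                  ≡⟨ +-identityʳ (h 0) ⟩
    h 0                      ∎
    where open ≡-Reasoning
  ∑-χ≟ (suc n) {suc y} h (s≤s y<n) = trans
    (∑-cong n (λ i _ → cong (_* h (suc i)) (χ-cong (suc i ≟ suc y) (i ≟ y) suc-injective (cong suc))))
    (∑-χ≟ n (h ∘ suc) y<n)

  ∑-χ-unique : ∀ n {P : Pred ℕ 0ℓ} (P? : Decidable P) {y} (h : ℕ → ℕ) → y < n → P y →
    (∀ i → i < n → P i → i ≡ y) → ∑[ i < n ] (χ (P? i) * h i) ≡ h y
  ∑-χ-unique n P? h y<n Py unique = trans
    (∑-cong n (λ i i<n → cong (_* h i) (χ-cong (P? i) (i ≟ _) (unique i i<n) (λ { refl → Py }))))
    (∑-χ≟ n h y<n)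

  # : ℕ → {P : Pred ℕ 0ℓ} → Decidable P → ℕ
  # n P? = ∑[ i < n ] χ (P? i)

  #-cong : ∀ n {P Q : Pred ℕ 0ℓ} (P? : Decidable P) (Q? : Decidable Q) →
    (∀ i → i < n → P i → Q i) → (∀ i → i < n → Q i → P i) → # n P? ≡ # n Q?
  #-cong n P? Q? P→Q Q→P = ∑-cong n (λ i i<n → χ-cong (P? i) (Q? i) (P→Q i i<n) (Q→P i i<n))

  #-mono-≤ : ∀ n {P Q : Pred ℕ 0ℓ} (P? : Decidable P) (Q? : Decidable Q) →
    (∀ i → i < n → P i → Q i) → # n P? ≤ # n Q?
  #-mono-≤ n P? Q? P→Q = ∑-mono-≤ n (λ i i<n → χ-mono-≤ (P? i) (Q? i) (P→Q i i<n))

  #-none : ∀ n {P : Pred ℕ 0ℓ} (P? : Decidable P) → (∀ i → i < n → ¬ P i) → # n P? ≡ 0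
  #-none n P? none = trans (∑-cong n (λ i i<n → χ-no (P? i) (none i i<n))) (trans (∑-const n 0) (*-zeroʳ n))

  #-witness : ∀ n {P : Pred ℕ 0ℓ} (P? : Decidable P) → 1 ≤ # n P? → ∃[ y ] y < n × P y
  #-witness (suc n) P? pos with P? 0
  ... | yes P0 = 0 , z<s , P0
  ... | no _ with #-witness n (P? ∘ suc) pos
  ...   | y , y<n , Py = suc y , s<s y<n , Py

  #-remove : ∀ n {P : Pred ℕ 0ℓ} (P? : Decidable P) {k} → k < n → P k →
    # n P? ≡ suc (# n (λ i → P? i ×-dec ¬? (i ≟ k)))
  #-remove n P? {k} k<n Pk = begin
    ∑[ i < n ] χ (P? i)                                          ≡⟨ ∑-cong n (λ i _ → split i) ⟩
    ∑[ i < n ] (χ (P? i ×-dec ¬? (i ≟ k)) + χ (i ≟ k) * χ (P? i)) ≡⟨ ∑-distrib-+ n _ _ ⟩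
    rest + ∑[ i < n ] (χ (i ≟ k) * χ (P? i))                      ≡⟨ cong (rest +_) (∑-χ≟ n (χ ∘ P?) k<n) ⟩
    rest + χ (P? k)                                               ≡⟨ cong (rest +_) (χ-yes (P? k) Pk) ⟩
    rest + 1                                                      ≡⟨ +-comm rest 1 ⟩
    suc rest                                                      ∎
    where
    open ≡-Reasoning
    rest = # n (λ i → P? i ×-dec ¬? (i ≟ k))
    split : ∀ i → χ (P? i) ≡ χ (P? i ×-dec ¬? (i ≟ k)) + χ (i ≟ k) * χ (P? i)
    split i with P? i | i ≟ k
    ... | yes _ | yes _ = refl
    ... | yes _ | no _  = refl
    ... | no _  | yes _ = refl
    ... | no _  | no _  = refl

  #-≤-injection : ∀ n m {P Q : Pred ℕ 0ℓ} (P? : Decidable P) (Q? : Decidable Q) (f : ℕ → ℕ) →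
    (∀ i → i < n → P i → f i < m × Q (f i)) →
    (∀ i j → i < n → j < n → P i → P j → f i ≡ f j → i ≡ j) →
    # n P? ≤ # m Q?
  #-≤-injection zero    m P? Q? f maps inj = z≤n
  #-≤-injection (suc n) m {P} {Q} P? Q? f maps inj with P? 0
  ... | no _ = #-≤-injection n m (P? ∘ suc) Q? (f ∘ suc)
    (λ i i<n → maps (suc i) (s<s i<n))
    (λ i j i<n j<n Pi Pj eq → suc-injective (inj (suc i) (suc j) (s<s i<n) (s<s j<n) Pi Pj eq))
  ... | yes P0 with maps 0 z<s P0
  ...   | f0<m , Qf0 = subst (suc (# n (P? ∘ suc)) ≤_) (sym (#-remove m Q? f0<m Qf0))
    (s≤s (#-≤-injection n m (P? ∘ suc) (λ i → Q? i ×-dec ¬? (i ≟ f 0)) (f ∘ suc) maps′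
      (λ i j i<n j<n Pi Pj eq → suc-injective (inj (suc i) (suc j) (s<s i<n) (s<s j<n) Pi Pj eq))))
    where
    maps′ : ∀ i → i < n → P (suc i) → f (suc i) < m × (Q (f (suc i)) × ¬ f (suc i) ≡ f 0)
    maps′ i i<n Pi = proj₁ (maps (suc i) (s<s i<n) Pi) , proj₂ (maps (suc i) (s<s i<n) Pi) ,
      λ eq → 0≢1+n (sym (inj (suc i) 0 (s<s i<n) z<s Pi P0 eq))

  #≤1 : ∀ n {P : Pred ℕ 0ℓ} (P? : Decidable P) → (∀ i j → i < n → j < n → P i → P j → i ≡ j) → # n P? ≤ 1
  #≤1 n P? unique = #-≤-injection n 1 P? (λ _ → yes tt) (λ _ → 0) (λ _ _ _ → z<s , tt)
    (λ i j i<n j<n Pi Pj _ → unique i j i<n j<n Pi Pj)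

  #≥1 : ∀ n {P : Pred ℕ 0ℓ} (P? : Decidable P) {y} → y < n → P y → 1 ≤ # n P?
  #≥1 n P? {y} y<n Py = subst (_≤ # n P?) (trans (∑-χ≟ n (χ ∘ P?) y<n) (χ-yes (P? y) Py))
    (∑-mono-≤ n (λ i _ → δ*χ≤χ i))
    where
    δ*χ≤χ : ∀ i → χ (i ≟ y) * χ (P? i) ≤ χ (P? i)
    δ*χ≤χ i with i ≟ y
    ... | yes _ = ≤-reflexive (+-identityʳ _)
    ... | no _  = z≤n

  #≡1 : ∀ n {P : Pred ℕ 0ℓ} (P? : Decidable P) {y} → y < n → P y →
    (∀ i j → i < n → j < n → P i → P j → i ≡ j) → # n P? ≡ 1
  #≡1 n P? y<n Py unique = ≤-antisym (#≤1 n P? unique) (#≥1 n P? y<n Py)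

  ∑-list : {A : Set} → List A → (A → ℕ) → ℕ
  ∑-list []       f = 0
  ∑-list (x ∷ xs) f = f x + ∑-list xs f

  ∑-list-++ : {A : Set} (xs ys : List A) (f : A → ℕ) → ∑-list (xs ++ ys) f ≡ ∑-list xs f + ∑-list ys f
  ∑-list-++ []       ys f = refl
  ∑-list-++ (x ∷ xs) ys f = trans (cong (f x +_) (∑-list-++ xs ys f)) (sym (+-assoc (f x) _ _))

  ∑-list-map : {A B : Set} (g : A → B) (xs : List A) (f : B → ℕ) → ∑-list (map g xs) f ≡ ∑-list xs (f ∘ g)
  ∑-list-map g []       f = refl
  ∑-list-map g (x ∷ xs) f = cong (f (g x) +_) (∑-list-map g xs f)

  ∑-list-applyUpTo : {A : Set} (g : ℕ → A) (n : ℕ) (f : A → ℕ) → ∑-list (applyUpTo g n) f ≡ ∑ n (f ∘ g)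
  ∑-list-applyUpTo g zero    f = refl
  ∑-list-applyUpTo g (suc n) f = cong (f (g 0) +_) (∑-list-applyUpTo (g ∘ suc) n f)

  length-filter≡∑χ : {A : Set} {P : Pred A 0ℓ} (P? : Decidable P) (xs : List A) →
    length (filter P? xs) ≡ ∑-list xs (χ ∘ P?)
  length-filter≡∑χ P? []       = refl
  length-filter≡∑χ P? (x ∷ xs) with P? x
  ... | yes _ = cong suc (length-filter≡∑χ P? xs)
  ... | no _  = length-filter≡∑χ P? xs

  length-filter-upTo² : {P : Pred (ℕ × ℕ) 0ℓ} (P? : Decidable P) (n : ℕ) →
    length (filter P? (cartesianProduct (upTo n) (upTo n))) ≡ ∑[ a < n ] ∑[ b < n ] χ (P? (a , b))
  length-filter-upTo² P? n = trans (length-filter≡∑χ P? (cartesianProduct (upTo n) (upTo n)))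
    (trans (rows (upTo n)) (∑-list-applyUpTo (λ a → a) n _))
    where
    rows : ∀ as → ∑-list (cartesianProduct as (upTo n)) (χ ∘ P?) ≡ ∑-list as (λ a → ∑[ b < n ] χ (P? (a , b)))
    rows []       = refl
    rows (a ∷ as) = trans (∑-list-++ (map (a ,_) (upTo n)) _ (χ ∘ P?))
      (cong₂ _+_ (trans (∑-list-map (a ,_) (upTo n) (χ ∘ P?)) (∑-list-applyUpTo (λ b → b) n _)) (rows as))

module Binomial where

  open import Data.Nat
  open import Data.Nat.Properties
  open import Data.Nat.Combinatorics using (_C_; k>n⇒nCk≡0; nC1≡n; nCk+nC[k+1]≡[n+1]C[k+1])
  open import Data.Nat.Divisibility using (_∣_; divides; >⇒∤)
  open import Data.Nat.Primality using (Prime; euclidsLemma)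
  open import Data.Nat.Tactic.RingSolver using (solve-∀)
  open import Data.Sum using (inj₁; inj₂)
  open import Data.Empty using (⊥-elim)
  open import Relation.Binary.PropositionalEquality

  [1+k]*[1+n]C[1+k]≡[1+n]*nCk : ∀ n k → suc k * (suc n C suc k) ≡ suc n * (n C k)
  [1+k]*[1+n]C[1+k]≡[1+n]*nCk zero    zero    = refl
  [1+k]*[1+n]C[1+k]≡[1+n]*nCk zero    (suc k) =
    trans (cong (2+ k *_) (k>n⇒nCk≡0 {1} {2+ k} (s≤s (s≤s z≤n)))) (*-zeroʳ (2+ k))
  [1+k]*[1+n]C[1+k]≡[1+n]*nCk (suc n) zero    =
    trans (+-identityʳ _) (trans (nC1≡n (2+ n)) (sym (*-identityʳ _)))
  [1+k]*[1+n]C[1+k]≡[1+n]*nCk (suc n) (suc k) = begin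
    2+ k * (2+ n C 2+ k)                           ≡⟨ cong (2+ k *_) (nCk+nC[k+1]≡[n+1]C[k+1] (suc n) (suc k)) ⟨
    2+ k * (A + B)                                 ≡⟨ distribute k A B ⟩
    A + (suc k * A + 2+ k * B)                     ≡⟨ cong₂ (λ u v → A + (u + v)) ([1+k]*[1+n]C[1+k]≡[1+n]*nCk n k)
                                                                                     ([1+k]*[1+n]C[1+k]≡[1+n]*nCk n (suc k)) ⟩
    A + (suc n * (n C k) + suc n * (n C suc k))    ≡⟨ cong (A +_) (*-distribˡ-+ (suc n) (n C k) (n C suc k)) ⟨
    A + suc n * (n C k + n C suc k)                ≡⟨ cong (λ t → A + suc n * t) (nCk+nC[k+1]≡[n+1]C[k+1] n k) ⟩
    2+ n * A                                       ∎
    where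
    open ≡-Reasoning
    A = suc n C suc k
    B = suc n C 2+ k
    distribute : ∀ k A B → 2+ k * (A + B) ≡ A + (suc k * A + 2+ k * B)
    distribute = solve-∀

  p∣pCk : ∀ {p} → Prime p → ∀ {k} → 0 < k → k < p → p ∣ p C k
  p∣pCk {suc n} p-prime {suc k} _ k<p
    with euclidsLemma (suc k) (suc n C suc k) p-prime
           (divides (n C k) (trans ([1+k]*[1+n]C[1+k]≡[1+n]*nCk n k) (*-comm (suc n) (n C k))))
  ... | inj₁ p∣1+k = ⊥-elim (>⇒∤ k<p p∣1+k)
  ... | inj₂ p∣pCk = p∣pCk

module ModPrime (p : ℕ) (p-prime : Prime p) where

  open import Data.Nat as ℕ using (ℕ; zero; suc; NonZero; s≤s; z<s)
  import Data.Nat.Properties as ℕ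
  open import Data.Nat.Primality using (euclidsLemma; prime⇒nonZero; prime⇒nonTrivial)
  open import Data.Nat.Combinatorics using (_C_; nCn≡1)
  import Data.Nat.Divisibility as ℕ
  open import Data.Integer as ℤ using (ℤ; +_; ∣_∣; _+_; _*_; _-_; -_; _^_; 0ℤ; 1ℤ)
  import Data.Integer.Properties as ℤ
  open import Data.Integer.Properties using (+-*-commutativeSemiring)
  open import Data.Integer.Divisibility.Signed using (_∣_; divides; ∣ᵤ⇒∣; ∣⇒∣ᵤ;
    ∣m∣n⇒∣m+n; ∣m∣n⇒∣m-n; ∣m⇒∣-m; ∣n⇒∣m*n; ∣m⇒∣m*n)
  open import Data.Integer.DivMod using (_%ℕ_; _/ℕ_; n%ℕd<d; a≡a%ℕn+[a/ℕn]*n)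
  open import Data.Integer.Tactic.RingSolver using (solve-∀)
  open import Data.Fin as Fin using (Fin; toℕ; inject₁)
  import Data.Fin.Properties as Fin
  open import Data.Vec.Functional using (Vector; init; last)
  open import Data.Sum using (_⊎_; inj₁; inj₂)
  open import Data.Empty using (⊥-elim)
  open import Function using (_∘_)
  open import Level using (0ℓ)
  open import Algebra.Bundles using (CommutativeSemiring)
  open import Relation.Nullary using (Dec; ¬_)
  open import Relation.Nullary.Decidable using (map′)
  open import Relation.Binary.Bundles using (Setoid)
  import Relation.Binary.Reasoning.Setoid as SetoidReasoning
  open import Relation.Binary.PropositionalEquality
  open import Defs using (_≡[mod_]_)
  open Binomial using (p∣pCk)
  open FiniteSum

  instance
    p-nonZero : NonZero p
    p-nonZero = prime⇒nonZero p-prime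

  1<p : 1 ℕ.< p
  1<p = ℕ.nonTrivial⇒n>1 p {{prime⇒nonTrivial p-prime}}

  p∣_ : ℤ → Set
  p∣ x = + p ∣ x

  p∣? : ∀ x → Dec (p∣ x)
  p∣? x = map′ ∣ᵤ⇒∣ ∣⇒∣ᵤ (p ℕ.∣? ∣ x ∣)

  p∣-+ : ∀ {a b} → p∣ a → p∣ b → p∣ (a + b)
  p∣-+ = ∣m∣n⇒∣m+n

  p∣-- : ∀ {a b} → p∣ a → p∣ b → p∣ (a - b)
  p∣-- = ∣m∣n⇒∣m-n

  p∣-neg : ∀ {a} → p∣ a → p∣ (- a)
  p∣-neg = ∣m⇒∣-m

  p∣-*ˡ : ∀ c {a} → p∣ a → p∣ (c * a)
  p∣-*ˡ = ∣n⇒∣m*n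

  p∣-*ʳ : ∀ c {a} → p∣ a → p∣ (a * c)
  p∣-*ʳ c = ∣m⇒∣m*n c

  p∣0 : p∣ 0ℤ
  p∣0 = divides 0ℤ refl

  p∣p : p∣ (+ p)
  p∣p = divides 1ℤ (sym (ℤ.*-identityˡ (+ p)))

  euclid : ∀ a b → p∣ (a * b) → p∣ a ⊎ p∣ b
  euclid a b p∣ab with euclidsLemma ∣ a ∣ ∣ b ∣ p-prime (subst (p ℕ.∣_) (ℤ.abs-* a b) (∣⇒∣ᵤ p∣ab))
  ... | inj₁ p∣a = inj₁ (∣ᵤ⇒∣ p∣a)
  ... | inj₂ p∣b = inj₂ (∣ᵤ⇒∣ p∣b)

  p∣-*-cancelˡ : ∀ {a b} → ¬ p∣ a → p∣ (a * b) → p∣ b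
  p∣-*-cancelˡ {a} {b} p∤a p∣ab with euclid a b p∣ab
  ... | inj₁ p∣a = ⊥-elim (p∤a p∣a)
  ... | inj₂ p∣b = p∣b

  p∤-* : ∀ {a b} → ¬ p∣ a → ¬ p∣ b → ¬ p∣ (a * b)
  p∤-* p∤a p∤b p∣ab = p∤b (p∣-*-cancelˡ p∤a p∣ab)

  p∣[+n]⇒n≡0 : ∀ {n} → n ℕ.< p → p∣ (+ n) → n ≡ 0
  p∣[+n]⇒n≡0 {zero}  _   _    = refl
  p∣[+n]⇒n≡0 {suc n} n<p p∣n = ⊥-elim (ℕ.>⇒∤ n<p (∣⇒∣ᵤ p∣n))

  p∤[+n] : ∀ {n} → 0 ℕ.< n → n ℕ.< p → ¬ p∣ (+ n)
  p∤[+n] {suc n} _ n<p p∣n with p∣[+n]⇒n≡0 n<p p∣n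
  ... | ()

  p∤1 : ¬ p∣ 1ℤ
  p∤1 = p∤[+n] z<s 1<p

  p∣^⇒p∣ : ∀ n x → p∣ (x ^ n) → p∣ x
  p∣^⇒p∣ zero    x p∣1 = ⊥-elim (p∤1 p∣1)
  p∣^⇒p∣ (suc n) x p∣xⁿ⁺¹ with euclid x (x ^ n) p∣xⁿ⁺¹
  ... | inj₁ p∣x  = p∣x
  ... | inj₂ p∣xⁿ = p∣^⇒p∣ n x p∣xⁿ

  p∣⇒p∣^ : ∀ n {x} → 1 ℕ.≤ n → p∣ x → p∣ (x ^ n)
  p∣⇒p∣^ (suc n) _ p∣x = p∣-*ʳ _ p∣x

  infix 4 _≈_ _≈?_

  -- a record rather than p∣ (x - y), so that x and y can be inferred from a proof of x ≈ y
  record _≈_ (x y : ℤ) : Set where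
    constructor mk≈
    field p∣x-y : p∣ (x - y)
  open _≈_ public

  _≈?_ : ∀ x y → Dec (x ≈ y)
  x ≈? y = map′ mk≈ p∣x-y (p∣? (x - y))

  ≡mod⇒≈ : ∀ {x y} → x ≡[mod p ] y → x ≈ y
  ≡mod⇒≈ x≡y = mk≈ (∣ᵤ⇒∣ x≡y)

  ≈⇒≡mod : ∀ {x y} → x ≈ y → x ≡[mod p ] y
  ≈⇒≡mod x≈y = ∣⇒∣ᵤ (p∣x-y x≈y)

  ≈-refl : ∀ {x} → x ≈ x
  ≈-refl {x} = mk≈ (subst p∣_ (sym (ℤ.+-inverseʳ x)) p∣0)

  ≈-reflexive : ∀ {x y} → x ≡ y → x ≈ y
  ≈-reflexive refl = ≈-refl

  ≈-sym : ∀ {x y} → x ≈ y → y ≈ x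
  ≈-sym {x} {y} (mk≈ h) = mk≈ (subst p∣_ (negate x y) (p∣-neg h))
    where
    negate : ∀ x y → - (x - y) ≡ y - x
    negate = solve-∀

  ≈-trans : ∀ {x y z} → x ≈ y → y ≈ z → x ≈ z
  ≈-trans {x} {y} {z} (mk≈ h) (mk≈ k) = mk≈ (subst p∣_ (telescope x y z) (p∣-+ h k))
    where
    telescope : ∀ x y z → (x - y) + (y - z) ≡ x - z
    telescope = solve-∀

  ≈-setoid : Setoid 0ℓ 0ℓ
  ≈-setoid = record
    { Carrier = ℤ ; _≈_ = _≈_ ; isEquivalence = record { refl = ≈-refl ; sym = ≈-sym ; trans = ≈-trans } }

  module ≈-Reasoning = SetoidReasoning ≈-setoid

  ≈-+ : ∀ {x y u v} → x ≈ y → u ≈ v → x + u ≈ y + v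
  ≈-+ {x} {y} {u} {v} (mk≈ h) (mk≈ k) = mk≈ (subst p∣_ (rearrange x y u v) (p∣-+ h k))
    where
    rearrange : ∀ x y u v → (x - y) + (u - v) ≡ (x + u) - (y + v)
    rearrange = solve-∀

  ≈-- : ∀ {x y u v} → x ≈ y → u ≈ v → x - u ≈ y - v
  ≈-- {x} {y} {u} {v} (mk≈ h) (mk≈ k) = mk≈ (subst p∣_ (rearrange x y u v) (p∣-- h k))
    where
    rearrange : ∀ x y u v → (x - y) - (u - v) ≡ (x - u) - (y - v)
    rearrange = solve-∀

  ≈-* : ∀ {x y u v} → x ≈ y → u ≈ v → x * u ≈ y * v
  ≈-* {x} {y} {u} {v} (mk≈ h) (mk≈ k) = mk≈ (subst p∣_ (rearrange x y u v) (p∣-+ (p∣-*ʳ u h) (p∣-*ˡ y k)))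
    where
    rearrange : ∀ x y u v → (x - y) * u + y * (u - v) ≡ x * u - y * v
    rearrange = solve-∀

  ≈-^ : ∀ {x y} n → x ≈ y → x ^ n ≈ y ^ n
  ≈-^ zero    _   = ≈-refl
  ≈-^ (suc n) x≈y = ≈-* x≈y (≈-^ n x≈y)

  p∣-≈ : ∀ {a b} → p∣ a → a ≈ b → p∣ b
  p∣-≈ {a} {b} p∣a (mk≈ h) = subst p∣_ (cancel a b) (p∣-- p∣a h)
    where
    cancel : ∀ a b → a - (a - b) ≡ b
    cancel = solve-∀

  ≈0⇒p∣ : ∀ {a} → a ≈ 0ℤ → p∣ a
  ≈0⇒p∣ {a} (mk≈ h) = subst p∣_ (ℤ.+-identityʳ a) h

  *-cancelˡ-≈ : ∀ {a x y} → ¬ p∣ a → a * x ≈ a * y → x ≈ y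
  *-cancelˡ-≈ {a} {x} {y} p∤a (mk≈ h) = mk≈ (p∣-*-cancelˡ p∤a (subst p∣_ (factor a x y) h))
    where
    factor : ∀ a x y → a * x - a * y ≡ a * (x - y)
    factor = solve-∀

  +-injective-≈-≤ : ∀ {a b} → a ℕ.≤ b → b ℕ.< p → + a ≈ + b → a ≡ b
  +-injective-≈-≤ {a} {b} a≤b b<p (mk≈ h) = ℕ.≤-antisym a≤b (ℕ.m∸n≡0⇒m≤n (p∣[+n]⇒n≡0 (ℕ.≤-<-trans (ℕ.m∸n≤m b a) b<p)
    (∣ᵤ⇒∣ (subst (p ℕ.∣_) (trans (cong ∣_∣ (ℤ.[+m]-[+n]≡m⊖n a b)) (ℤ.∣⊖∣-≤ a≤b)) (∣⇒∣ᵤ h)))))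

  +-injective-≈ : ∀ {a b} → a ℕ.< p → b ℕ.< p → + a ≈ + b → a ≡ b
  +-injective-≈ {a} {b} a<p b<p a≈b with ℕ.≤-total a b
  ... | inj₁ a≤b = +-injective-≈-≤ a≤b b<p a≈b
  ... | inj₂ b≤a = sym (+-injective-≈-≤ b≤a a<p (≈-sym a≈b))

  rep : ℤ → ℕ
  rep z = z %ℕ p

  rep<p : ∀ z → rep z ℕ.< p
  rep<p z = n%ℕd<d z p

  rep≈ : ∀ z → z ≈ + rep z
  rep≈ z = mk≈ (subst p∣_ (sym z-rep≡q*p) (p∣-*ˡ (z /ℕ p) p∣p))
    where
    z-rep≡q*p : z - + rep z ≡ (z /ℕ p) * + p
    z-rep≡q*p = trans (cong (λ t → t - + rep z) (a≡a%ℕn+[a/ℕn]*n z p)) (cancel (+ rep z) ((z /ℕ p) * + p))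
      where
      cancel : ∀ r t → (r + t) - r ≡ t
      cancel = solve-∀

  #-representatives : ∀ z → # p (λ y → + y ≈? z) ≡ 1
  #-representatives z = #≡1 p (λ y → + y ≈? z) (rep<p z) (≈-sym (rep≈ z))
    (λ i j i<p j<p i≈z j≈z → +-injective-≈ i<p j<p (≈-trans i≈z (≈-sym j≈z)))

  ∑-representative : ∀ z (h : ℕ → ℕ) → ∑[ y < p ] (χ (+ y ≈? z) ℕ.* h y) ≡ h (rep z)
  ∑-representative z h = ∑-χ-unique p (λ y → + y ≈? z) h (rep<p z) (≈-sym (rep≈ z))
    (λ i i<p i≈z → +-injective-≈ i<p (rep<p z) (≈-trans i≈z (rep≈ z)))

  [x+1]^p≈x^p+1 : ∀ x → (x + 1ℤ) ^ p ≈ x ^ p + 1ℤ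
  [x+1]^p≈x^p+1 x = subst (λ n → (x + 1ℤ) ^ n ≈ x ^ n + 1ℤ) (ℕ.suc-pred p) (mk≈ (subst p∣_ expansion (sum-p∣ middle-p∣)))
    where
    open CommutativeSemiring +-*-commutativeSemiring using (semiring)
    open import Algebra.Properties.CommutativeSemiring.Binomial +-*-commutativeSemiring
      using (theorem; binomialTerm; binomial)
    open import Algebra.Properties.Semiring.Exp semiring using () renaming (_^_ to _^′_)
    open import Algebra.Properties.Semiring.Mult semiring using () renaming (_×_ to _×′_)
    open import Algebra.Properties.Semiring.Sum semiring using (sum; sum-init-last)

    ^′≡^ : ∀ x n → x ^′ n ≡ x ^ n
    ^′≡^ x zero    = refl
    ^′≡^ x (suc n) = cong (x *_) (^′≡^ x n)

    ×′≡* : ∀ n x → n ×′ x ≡ + n * x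
    ×′≡* zero    x = sym (ℤ.*-zeroˡ x)
    ×′≡* (suc n) x = trans (cong (λ u → x + u) (×′≡* n x)) (sym (expand (+ n) x))
      where
      expand : ∀ a x → (1ℤ + a) * x ≡ x + a * x
      expand = solve-∀

    sum-p∣ : ∀ {n} {f : Vector ℤ n} → (∀ k → p∣ (f k)) → p∣ (sum f)
    sum-p∣ {zero}  _   = p∣0
    sum-p∣ {suc n} p∣f = p∣-+ (p∣f Fin.zero) (sum-p∣ (p∣f ∘ Fin.suc))

    m = ℕ.pred p
    t = binomialTerm x 1ℤ (suc m)
    middle = init (t ∘ Fin.suc)

    middle-p∣ : ∀ j → p∣ (middle j)
    middle-p∣ j = subst p∣_ (sym (×′≡* (suc m C suc i) w)) (p∣-*ʳ w p∣C)
      where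
      i = toℕ (inject₁ j)
      w = binomial x 1ℤ (suc m) (Fin.suc (inject₁ j))
      i<m : suc i ℕ.< p
      i<m = subst (suc i ℕ.<_) (ℕ.suc-pred p) (s≤s (subst (ℕ._< m) (sym (Fin.toℕ-inject₁ j)) (Fin.toℕ<n j)))
      p∣C : p∣ (+ (suc m C suc i))
      p∣C = ∣ᵤ⇒∣ (subst (λ n → p ℕ.∣ n C suc i) (sym (ℕ.suc-pred p)) (p∣pCk p-prime z<s i<m))

    first : t Fin.zero ≡ 1ℤ
    first = trans (×′≡* 1 _) (trans (ℤ.*-identityˡ _) (trans (ℤ.*-identityˡ _) (trans (^′≡^ 1ℤ (suc m)) (ℤ.^-zeroˡ (suc m)))))

    final : last (t ∘ Fin.suc) ≡ x ^ suc m
    final rewrite Fin.toℕ-fromℕ m | nCn≡1 (suc m) | ℕ.n∸n≡0 m =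
      trans (×′≡* 1 _) (trans (ℤ.*-identityˡ _) (trans (ℤ.*-identityʳ _) (^′≡^ x (suc m))))

    expansion : sum middle ≡ (x + 1ℤ) ^ suc m - (x ^ suc m + 1ℤ)
    expansion = begin
      sum middle                                                           ≡⟨ isolate (sum middle) (x ^ suc m) ⟩
      (1ℤ + (sum middle + x ^ suc m)) - (x ^ suc m + 1ℤ)                   ≡⟨ cong₂ (λ u v → (u + (sum middle + v)) - (x ^ suc m + 1ℤ))
                                                                                     (sym first) (sym final) ⟩
      (t Fin.zero + (sum middle + last (t ∘ Fin.suc))) - (x ^ suc m + 1ℤ) ≡⟨ cong (λ u → (t Fin.zero + u) - (x ^ suc m + 1ℤ))
                                                                                     (sym (sum-init-last (t ∘ Fin.suc))) ⟩
      sum t - (x ^ suc m + 1ℤ)                                             ≡⟨ cong (_- (x ^ suc m + 1ℤ)) (sym (theorem (suc m) x 1ℤ)) ⟩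
      (x + 1ℤ) ^′ suc m - (x ^ suc m + 1ℤ)                                 ≡⟨ cong (_- (x ^ suc m + 1ℤ)) (^′≡^ (x + 1ℤ) (suc m)) ⟩
      (x + 1ℤ) ^ suc m - (x ^ suc m + 1ℤ)                                  ∎
      where
      open ≡-Reasoning
      isolate : ∀ M X → M ≡ (1ℤ + (M + X)) - (X + 1ℤ)
      isolate = solve-∀

  x^p≈x : ∀ z → z ^ p ≈ z
  x^p≈x z = ≈-trans (≈-^ p (rep≈ z)) (≈-trans (n^p≈n (rep z)) (≈-sym (rep≈ z)))
    where
    n^p≈n : ∀ n → (+ n) ^ p ≈ + n
    n^p≈n zero    = ≈-reflexive (trans (cong (0ℤ ^_) (sym (ℕ.suc-pred p))) (ℤ.*-zeroˡ (0ℤ ^ ℕ.pred p)))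
    n^p≈n (suc n) = ≈-trans (≈-reflexive (cong (_^ p) 1+n≡n+1))
      (≈-trans ([x+1]^p≈x^p+1 (+ n)) (≈-trans (≈-+ (n^p≈n n) ≈-refl) (≈-reflexive (sym 1+n≡n+1))))
      where
      1+n≡n+1 : + suc n ≡ + n + 1ℤ
      1+n≡n+1 = cong +_ (ℕ.+-comm 1 n)

  x^[p-1]≈1 : ∀ z → ¬ p∣ z → z ^ ℕ.pred p ≈ 1ℤ
  x^[p-1]≈1 z p∤z = *-cancelˡ-≈ p∤z (≈-trans (≈-reflexive (cong (z ^_) (ℕ.suc-pred p)))
    (≈-trans (x^p≈x z) (≈-reflexive (sym (ℤ.*-identityʳ z)))))

  module FibreCounts (v : ℕ → ℕ → ℤ) where

    fibre₂ : ℕ → ℕ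
    fibre₂ y = ∑[ a < p ] ∑[ b < p ] χ (+ y ≈? v a b)

    ∑-fibre₂ : ∑ p fibre₂ ≡ p ℕ.* p
    ∑-fibre₂ = begin
      ∑[ y < p ] ∑[ a < p ] ∑[ b < p ] χ (+ y ≈? v a b) ≡⟨ ∑-swap p p _ ⟩
      ∑[ a < p ] ∑[ y < p ] ∑[ b < p ] χ (+ y ≈? v a b) ≡⟨ ∑-cong p (λ a _ → ∑-swap p p _) ⟩
      ∑[ a < p ] ∑[ b < p ] ∑[ y < p ] χ (+ y ≈? v a b) ≡⟨ ∑-cong p (λ a _ → ∑-cong p (λ b _ → #-representatives (v a b))) ⟩
      ∑[ a < p ] ∑[ b < p ] 1                           ≡⟨ ∑-cong p (λ a _ → trans (∑-const p 1) (ℕ.*-identityʳ p)) ⟩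
      ∑[ a < p ] p                                      ≡⟨ ∑-const p p ⟩
      p ℕ.* p                                           ∎
      where open ≡-Reasoning

    ∑-fibre₂² : ∑[ y < p ] (fibre₂ y ℕ.* fibre₂ y) ≡ ∑[ a < p ] ∑[ b < p ] ∑[ a′ < p ] ∑[ b′ < p ] χ (v a b ≈? v a′ b′)
    ∑-fibre₂² = begin
      ∑[ y < p ] (fibre₂ y ℕ.* fibre₂ y)                                  ≡⟨ ∑-cong p (λ y _ → expand y) ⟩
      ∑[ y < p ] ∑[ a < p ] ∑[ b < p ] (χ (+ y ≈? v a b) ℕ.* fibre₂ y) ≡⟨ ∑-swap p p _ ⟩
      ∑[ a < p ] ∑[ y < p ] ∑[ b < p ] (χ (+ y ≈? v a b) ℕ.* fibre₂ y) ≡⟨ ∑-cong p (λ a _ → ∑-swap p p _) ⟩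
      ∑[ a < p ] ∑[ b < p ] ∑[ y < p ] (χ (+ y ≈? v a b) ℕ.* fibre₂ y) ≡⟨ ∑-cong p (λ a _ → ∑-cong p (λ b _ →
                                                                             ∑-representative (v a b) fibre₂)) ⟩
      ∑[ a < p ] ∑[ b < p ] fibre₂ (rep (v a b))                          ≡⟨ ∑-cong p (λ a _ → ∑-cong p (λ b _ →
                                                                             fibre₂-rep (v a b))) ⟩
      ∑[ a < p ] ∑[ b < p ] ∑[ a′ < p ] ∑[ b′ < p ] χ (v a b ≈? v a′ b′) ∎
      where
      open ≡-Reasoning
      expand : ∀ y → fibre₂ y ℕ.* fibre₂ y ≡ ∑[ a < p ] ∑[ b < p ] (χ (+ y ≈? v a b) ℕ.* fibre₂ y)
      expand y = trans (*-distribʳ-∑ p (fibre₂ y) _)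
        (∑-cong p (λ a _ → *-distribʳ-∑ p (fibre₂ y) (λ b → χ (+ y ≈? v a b))))
      fibre₂-rep : ∀ z → fibre₂ (rep z) ≡ ∑[ a′ < p ] ∑[ b′ < p ] χ (z ≈? v a′ b′)
      fibre₂-rep z = ∑-cong p (λ a′ _ → ∑-cong p (λ b′ _ → χ-cong (+ rep z ≈? v a′ b′) (z ≈? v a′ b′)
        (≈-trans (rep≈ z)) (≈-trans (≈-sym (rep≈ z)))))

module Polynomial where

  open import Data.Nat as ℕ using (ℕ; zero; suc; z≤n; s≤s)
  import Data.Nat.Properties as ℕ
  open import Data.Nat.Primality using (Prime)
  open import Data.Integer as ℤ using (ℤ; +_; _+_; _*_; _-_; -_; _^_; 0ℤ; 1ℤ)
  open import Data.Integer.Tactic.RingSolver using (solve-∀)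
  open import Data.List using (List; []; _∷_; length)
  open import Data.List.Relation.Unary.All using (All; []; _∷_)
  open import Data.Sum using (inj₁; inj₂)
  open import Data.Product using (_×_; _,_)
  open import Data.Empty using (⊥-elim)
  open import Relation.Nullary using (¬_; ¬?)
  open import Relation.Nullary.Decidable using (_×-dec_)
  open import Relation.Binary.PropositionalEquality
  open FiniteSum

  eval : List ℤ → ℤ → ℤ
  eval []       x = 0ℤ
  eval (c ∷ cs) x = c + x * eval cs x

  quotient : ℤ → List ℤ → List ℤ
  quotient a []       = []
  quotient a (c ∷ cs) = (c + a * eval cs a) ∷ quotient a cs

  length-quotient : ∀ a cs → length (quotient a cs) ≡ length cs
  length-quotient a []       = refl
  length-quotient a (c ∷ cs) = cong suc (length-quotient a cs)

  x*f[x]-a*f[a]≡[x-a]*q[x] : ∀ a cs x → x * eval cs x - a * eval cs a ≡ (x - a) * eval (quotient a cs) x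
  x*f[x]-a*f[a]≡[x-a]*q[x] a [] x = base x a
    where
    base : ∀ x a → x * 0ℤ - a * 0ℤ ≡ (x - a) * 0ℤ
    base = solve-∀
  x*f[x]-a*f[a]≡[x-a]*q[x] a (c ∷ cs) x = begin
    x * (c + x * F) - a * (c + a * A)                ≡⟨ regroup x a c F A Q ⟩
    (x - a) * ((c + a * A) + x * Q) + x * ((x * F - a * A) - (x - a) * Q)
                                                     ≡⟨ cong (λ t → (x - a) * ((c + a * A) + x * Q) + x * (t - (x - a) * Q))
                                                             (x*f[x]-a*f[a]≡[x-a]*q[x] a cs x) ⟩
    (x - a) * ((c + a * A) + x * Q) + x * ((x - a) * Q - (x - a) * Q)
                                                     ≡⟨ cancel (x - a) ((c + a * A) + x * Q) x ((x - a) * Q) ⟩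
    (x - a) * ((c + a * A) + x * Q)                  ∎
    where
    open ≡-Reasoning
    F = eval cs x
    A = eval cs a
    Q = eval (quotient a cs) x
    regroup : ∀ x a c F A Q → x * (c + x * F) - a * (c + a * A) ≡
      (x - a) * ((c + a * A) + x * Q) + x * ((x * F - a * A) - (x - a) * Q)
    regroup = solve-∀
    cancel : ∀ u v x w → u * v + x * (w - w) ≡ u * v
    cancel = solve-∀

  monomial : ℕ → ℤ → List ℤ
  monomial zero    a = a ∷ []
  monomial (suc n) a = 0ℤ ∷ monomial n a

  length-monomial : ∀ n a → length (monomial n a) ≡ suc n
  length-monomial zero    a = refl
  length-monomial (suc n) a = cong suc (length-monomial n a)

  eval-monomial : ∀ n a x → eval (monomial n a) x ≡ a * x ^ n
  eval-monomial zero    a x = base a x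
    where
    base : ∀ a x → a + x * 0ℤ ≡ a * 1ℤ
    base = solve-∀
  eval-monomial (suc n) a x = trans (cong (λ t → 0ℤ + x * t) (eval-monomial n a x)) (shift a x (x ^ n))
    where
    shift : ∀ a x X → 0ℤ + x * (a * X) ≡ a * (x * X)
    shift = solve-∀

  module Roots (p : ℕ) (p-prime : Prime p) where

    open ModPrime p p-prime

    roots : List ℤ → ℕ
    roots f = # p (λ x → p∣? (eval f (+ x)))

    p∣-eval : ∀ f x → All p∣_ f → p∣ (eval f x)
    p∣-eval []      x []            = p∣0
    p∣-eval (c ∷ f) x (p∣c ∷ p∣f) = p∣-+ p∣c (p∣-*ˡ x (p∣-eval f x p∣f))

    All-p∣-quotient : ∀ a cs → All p∣_ (quotient a cs) → All p∣_ cs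
    All-p∣-quotient a []       []            = []
    All-p∣-quotient a (c ∷ cs) (p∣c′ ∷ p∣q) = p∣c ∷ p∣cs
      where
      p∣cs = All-p∣-quotient a cs p∣q
      p∣c : p∣ c
      p∣c = subst p∣_ (cancel c (a * eval cs a)) (p∣-- p∣c′ (p∣-*ˡ a (p∣-eval cs a p∣cs)))
        where
        cancel : ∀ c t → (c + t) - t ≡ c
        cancel = solve-∀

    length≤roots⇒All-p∣ : ∀ n f → length f ≡ n → length f ℕ.≤ roots f → All p∣_ f
    length≤roots⇒All-p∣ n       []       _  _ = []
    length≤roots⇒All-p∣ zero    (c ∷ cs) () _
    length≤roots⇒All-p∣ (suc n) (c ∷ cs) eq many
      with #-witness p (λ x → p∣? (eval (c ∷ cs) (+ x))) (ℕ.≤-trans (s≤s z≤n) many)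
    ... | a , a<p , p∣f[a] = p∣c ∷ p∣cs
      where
      f? = λ x → p∣? (eval (c ∷ cs) (+ x))
      q? = λ x → p∣? (eval (quotient (+ a) cs) (+ x))
      other-root : ∀ x → x ℕ.< p → (p∣ (eval (c ∷ cs) (+ x)) × ¬ x ≡ a) → p∣ (eval (quotient (+ a) cs) (+ x))
      other-root x x<p (p∣f[x] , x≢a) with euclid (+ x - + a) (eval (quotient (+ a) cs) (+ x))
        (subst p∣_ (trans (cancel c (+ x) (+ a) (eval cs (+ x)) (eval cs (+ a))) (x*f[x]-a*f[a]≡[x-a]*q[x] (+ a) cs (+ x)))
                   (p∣-- p∣f[x] p∣f[a]))
        where
        cancel : ∀ c x a F A → (c + x * F) - (c + a * A) ≡ x * F - a * A
        cancel = solve-∀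
      ... | inj₁ p∣x-a = ⊥-elim (x≢a (+-injective-≈ x<p a<p (mk≈ p∣x-a)))
      ... | inj₂ p∣q[x] = p∣q[x]
      many′ : length (quotient (+ a) cs) ℕ.≤ roots (quotient (+ a) cs)
      many′ = subst (ℕ._≤ roots (quotient (+ a) cs)) (sym (length-quotient (+ a) cs))
        (ℕ.≤-trans (ℕ.s≤s⁻¹ (subst (suc (length cs) ℕ.≤_) (#-remove p f? a<p p∣f[a]) many))
                   (#-mono-≤ p (λ i → f? i ×-dec ¬? (i ℕ.≟ a)) q? other-root))
      p∣cs : All p∣_ cs
      p∣cs = All-p∣-quotient (+ a) cs
        (length≤roots⇒All-p∣ n (quotient (+ a) cs) (trans (length-quotient (+ a) cs) (ℕ.suc-injective eq)) many′)
      p∣c : p∣ c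
      p∣c = subst p∣_ (cancel c (+ a * eval cs (+ a))) (p∣-- p∣f[a] (p∣-*ˡ (+ a) (p∣-eval cs (+ a) p∣cs)))
        where
        cancel : ∀ c t → (c + t) - t ≡ c
        cancel = solve-∀

    roots<length : ∀ f → ¬ All p∣_ f → roots f ℕ.< length f
    roots<length f p∤f = ℕ.≰⇒> (λ many → p∤f (length≤roots⇒All-p∣ (length f) f refl many))

    #-solutions-a*xⁿ≈b : ∀ n → 1 ℕ.≤ n → ∀ {a} b → ¬ p∣ a → # p (λ x → a * (+ x) ^ n ≈? b) ℕ.≤ n
    #-solutions-a*xⁿ≈b (suc n) _ {a} b p∤a = ℕ.≤-trans
      (ℕ.≤-reflexive (#-cong p _ _ (λ x _ → root⇒p∣ x) (λ x _ → p∣⇒root x)))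
      (ℕ.s≤s⁻¹ (subst (roots f ℕ.<_) (cong suc (length-monomial n a)) (roots<length f leading)))
      where
      f = (- b) ∷ monomial n a
      eval-f : ∀ x → eval f x ≡ a * x ^ suc n - b
      eval-f x = trans (cong (λ t → - b + x * t) (eval-monomial n a x)) (rearrange a b x (x ^ n))
        where
        rearrange : ∀ a b x X → - b + x * (a * X) ≡ a * (x * X) - b
        rearrange = solve-∀
      leading : ¬ All p∣_ f
      leading (_ ∷ p∣coefficients) = p∤a (last p∣coefficients)
        where
        last : ∀ {n} → All p∣_ (monomial n a) → p∣ a
        last {zero}  (p∣a ∷ []) = p∣a
        last {suc n} (_ ∷ p∣m)  = last p∣m
      root⇒p∣ : ∀ x → a * (+ x) ^ suc n ≈ b → p∣ (eval f (+ x))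
      root⇒p∣ x (mk≈ h) = subst p∣_ (sym (eval-f (+ x))) h
      p∣⇒root : ∀ x → p∣ (eval f (+ x)) → a * (+ x) ^ suc n ≈ b
      p∣⇒root x h = mk≈ (subst p∣_ (eval-f (+ x)) h)

module PowerValues (p : ℕ) (p-prime : Prime p) (γ : ℤ) (r : ℕ) (r≥1 : 1 ≤ r) where

  open import Data.Nat as ℕ using (ℕ; zero; suc; z<s; s<s)
  open import Data.Integer as ℤ using (ℤ; +_; _*_; _^_; 0ℤ; 1ℤ)
  import Data.Nat.Properties as ℕ
  import Data.Integer.Properties as ℤ
  open import Data.Integer.Tactic.RingSolver using (solve-∀)
  open import Data.Product using (_×_; _,_; ∃-syntax)
  open import Function using (_∘_)
  open import Relation.Nullary using (¬_; Dec; yes; no)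
  open import Relation.Nullary.Decidable using (map′)
  open import Relation.Binary.PropositionalEquality
  open FiniteSum
  open ModPrime p p-prime
  open Polynomial using (module Roots)
  open Roots p p-prime using (#-solutions-a*xⁿ≈b)

  ^-distribʳ-* : ∀ a b n → (a * b) ^ n ≡ a ^ n * b ^ n
  ^-distribʳ-* a b zero    = refl
  ^-distribʳ-* a b (suc n) = trans (cong ((a * b) *_) (^-distribʳ-* a b n)) (interchange a b (a ^ n) (b ^ n))
    where
    interchange : ∀ a b A B → (a * b) * (A * B) ≡ (a * A) * (b * B)
    interchange = solve-∀

  InImage : ℕ → Set
  InImage y = ∃[ c ] c ℕ.< p × + y ≈ γ * (+ c) ^ r

  fibre : ℕ → ℕ
  fibre y = # p (λ c → + y ≈? γ * (+ c) ^ r)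

  InImage? : ∀ y → Dec (InImage y)
  InImage? y = map′ (#-witness p (λ c → + y ≈? γ * (+ c) ^ r))
                    (λ (c , c<p , y≈γcʳ) → #≥1 p (λ c → + y ≈? γ * (+ c) ^ r) c<p y≈γcʳ)
                    (1 ℕ.≤? fibre y)

  0^n≡0 : ∀ n → 1 ℕ.≤ n → 0ℤ ^ n ≡ 0ℤ
  0^n≡0 (suc n) _ = ℤ.*-zeroˡ (0ℤ ^ n)

  0∈image : InImage 0
  0∈image = 0 , ℕ.<-trans z<s 1<p , ≈-reflexive (sym (trans (cong (γ *_) (0^n≡0 r r≥1)) (ℤ.*-zeroʳ γ)))

  ∑-fibre : ∑ p fibre ≡ p
  ∑-fibre = begin
    ∑[ y < p ] ∑[ c < p ] χ (+ y ≈? γ * (+ c) ^ r) ≡⟨ ∑-swap p p _ ⟩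
    ∑[ c < p ] ∑[ y < p ] χ (+ y ≈? γ * (+ c) ^ r) ≡⟨ ∑-cong p (λ c _ → #-representatives (γ * (+ c) ^ r)) ⟩
    ∑[ c < p ] 1                                    ≡⟨ trans (∑-const p 1) (ℕ.*-identityʳ p) ⟩
    p                                               ∎
    where open ≡-Reasoning

  module _ (p∤γ : ¬ p∣ γ) where

    p∤[+c] : ∀ {y c} → 0 ℕ.< y → y ℕ.< p → + y ≈ γ * (+ c) ^ r → ¬ p∣ (+ c)
    p∤[+c] {y} 0<y y<p y≈γcʳ p∣c = p∤[+n] 0<y y<p (p∣-≈ (p∣-*ˡ γ (p∣⇒p∣^ r r≥1 p∣c)) (≈-sym y≈γcʳ))

    fibre[0]≤1 : fibre 0 ℕ.≤ 1
    fibre[0]≤1 = #≤1 p (λ c → + 0 ≈? γ * (+ c) ^ r)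
      (λ i j i<p j<p i-root j-root → trans (root⇒0 i<p i-root) (sym (root⇒0 j<p j-root)))
      where
      root⇒0 : ∀ {c} → c ℕ.< p → + 0 ≈ γ * (+ c) ^ r → c ≡ 0
      root⇒0 {c} c<p 0≈γcʳ = p∣[+n]⇒n≡0 c<p (p∣^⇒p∣ r (+ c) (p∣-*-cancelˡ p∤γ (≈0⇒p∣ (≈-sym 0≈γcʳ))))

    fibre≤r : ∀ y → fibre y ℕ.≤ r
    fibre≤r y = ℕ.≤-trans (ℕ.≤-reflexive (#-cong p _ _ (λ _ _ → ≈-sym) (λ _ _ → ≈-sym)))
                          (#-solutions-a*xⁿ≈b r r≥1 (+ y) p∤γ)

    fibre≤r*χ : ∀ y → fibre y ℕ.≤ r ℕ.* χ (InImage? y)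
    fibre≤r*χ y with InImage? y
    ... | yes _   = ℕ.≤-trans (fibre≤r y) (ℕ.≤-reflexive (sym (ℕ.*-identityʳ r)))
    ... | no  y∉ = ℕ.≤-reflexive (trans (#-none p _ (λ c c<p y≈γcʳ → y∉ (c , c<p , y≈γcʳ))) (sym (ℕ.*-zeroʳ r)))

    module _ (m : ℕ) (p-1≡m*r : ℕ.pred p ≡ m ℕ.* r) where

      #nonzero-values : ℕ
      #nonzero-values = # (ℕ.pred p) (InImage? ∘ suc)

      m≤#nonzero-values : m ℕ.≤ #nonzero-values
      m≤#nonzero-values = ℕ.*-cancelˡ-≤ r {{ℕ.>-nonZero r≥1}} (ℕ.s≤s⁻¹ (begin
        suc (r ℕ.* m)                                           ≡⟨ cong suc (trans (ℕ.*-comm r m) (sym p-1≡m*r)) ⟩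
        suc (ℕ.pred p)                                          ≡⟨ trans (ℕ.suc-pred p) (sym ∑-fibre) ⟩
        ∑ p fibre                                               ≡⟨ ∑-pred p fibre ⟩
        fibre 0 ℕ.+ ∑ (ℕ.pred p) (fibre ∘ suc)                  ≤⟨ ℕ.+-mono-≤ fibre[0]≤1 (∑-mono-≤ (ℕ.pred p) (λ y _ → fibre≤r*χ (suc y))) ⟩
        1 ℕ.+ ∑[ y < ℕ.pred p ] (r ℕ.* χ (InImage? (suc y)))    ≡⟨ cong suc (*-distribˡ-∑ (ℕ.pred p) r (χ ∘ InImage? ∘ suc)) ⟨
        suc (r ℕ.* #nonzero-values)                             ∎))
        where open ℕ.≤-Reasoning

      m≥1 : 1 ℕ.≤ m
      m≥1 = ℕ.>-nonZero⁻¹ m {{ℕ.m*n≢0⇒m≢0 m {{ℕ.>-nonZero (subst (0 ℕ.<_) p-1≡m*r (ℕ.m<n⇒0<n∸m 1<p))}}}}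

      #nonzero-values≤m : #nonzero-values ℕ.≤ m
      #nonzero-values≤m = ℕ.≤-trans
        (#-≤-injection (ℕ.pred p) p (InImage? ∘ suc) (λ y → 1ℤ * (+ y) ^ m ≈? γ ^ m) suc
          (λ y y<p-1 y+1∈ → y+1<p y<p-1 , mth-power (y+1<p y<p-1) y+1∈)
          (λ _ _ _ _ _ _ → ℕ.suc-injective))
        (#-solutions-a*xⁿ≈b m m≥1 (γ ^ m) p∤1)
        where
        open ≈-Reasoning
        y+1<p : ∀ {y} → y ℕ.< ℕ.pred p → suc y ℕ.< p
        y+1<p y<p-1 = subst (suc _ ℕ.<_) (ℕ.suc-pred p) (s<s y<p-1)
        mth-power : ∀ {y} → suc y ℕ.< p → InImage (suc y) → 1ℤ * (+ suc y) ^ m ≈ γ ^ m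
        mth-power {y} y+1<p (c , _ , y+1≈γcʳ) = begin
          1ℤ * (+ suc y) ^ m          ≡⟨ ℤ.*-identityˡ _ ⟩
          (+ suc y) ^ m               ≈⟨ ≈-^ m y+1≈γcʳ ⟩
          (γ * (+ c) ^ r) ^ m         ≡⟨ ^-distribʳ-* γ ((+ c) ^ r) m ⟩
          γ ^ m * ((+ c) ^ r) ^ m     ≡⟨ cong (γ ^ m *_) (ℤ.^-*-assoc (+ c) r m) ⟩
          γ ^ m * (+ c) ^ (r ℕ.* m)   ≡⟨ cong (λ k → γ ^ m * (+ c) ^ k) (trans (ℕ.*-comm r m) (sym p-1≡m*r)) ⟩
          γ ^ m * (+ c) ^ ℕ.pred p    ≈⟨ ≈-* (≈-refl {γ ^ m}) (x^[p-1]≈1 (+ c) (p∤[+c] z<s y+1<p y+1≈γcʳ)) ⟩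
          γ ^ m * 1ℤ                  ≡⟨ ℤ.*-identityʳ _ ⟩
          γ ^ m                       ∎

      #image≡1+m : # p InImage? ≡ suc m
      #image≡1+m = begin
        # p InImage?                               ≡⟨ ∑-pred p (χ ∘ InImage?) ⟩
        χ (InImage? 0) ℕ.+ #nonzero-values          ≡⟨ cong₂ ℕ._+_ (χ-yes (InImage? 0) 0∈image)
                                                            (ℕ.≤-antisym #nonzero-values≤m m≤#nonzero-values) ⟩
        suc m                                      ∎
        where open ≡-Reasoning

module DiscriminantFibres (p : ℕ) (p-prime : Prime p) (p∤6 : ¬ p Div.∣ 6) where

  open import Data.Nat as ℕ using (ℕ; suc; z≤n; s≤s; z<s; s<s)
  import Data.Nat.Divisibility as ℕ
  import Data.Nat.Properties as ℕ
  open import Data.Integer as ℤ using (ℤ; +_; _+_; _*_; _-_; -_; _^_; 0ℤ; 1ℤ)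
  import Data.Integer.Properties as ℤ
  open import Data.Integer.Divisibility.Signed using (∣⇒∣ᵤ)
  open import Data.Integer.Tactic.RingSolver using (solve-∀)
  import Data.Nat.Tactic.RingSolver as ℕ-Solver
  open import Data.Product using (_,_)
  open import Relation.Binary.PropositionalEquality
  open import Defs using (Δ)
  open FiniteSum
  open ModPrime p p-prime
  open Polynomial using (module Roots)
  open Roots p p-prime using (#-solutions-a*xⁿ≈b)

  open FibreCounts (λ a b → Δ (+ a) (+ b)) public

  p∤divisor-of-6 : ∀ d → d ℕ.∣ 6 → ¬ p∣ (+ d)
  p∤divisor-of-6 d d∣6 p∣d = p∤6 (ℕ.∣-trans (∣⇒∣ᵤ p∣d) d∣6)

  p∤2 : ¬ p∣ (+ 2)
  p∤2 = p∤divisor-of-6 2 (ℕ.divides 3 refl)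

  p∤3 : ¬ p∣ (+ 3)
  p∤3 = p∤divisor-of-6 3 (ℕ.divides 2 refl)

  p∤4 : ¬ p∣ (+ 4)
  p∤4 = p∤-* {+ 2} {+ 2} p∤2 p∤2

  p∤-16 : ¬ p∣ (- + 16)
  p∤-16 p∣-16 = p∤-* {+ 4} {+ 4} p∤4 p∤4 (p∣-neg p∣-16)

  p∤54 : ¬ p∣ (+ 54)
  p∤54 = p∤-* {+ 2} {+ 27} p∤2 (p∤-* {+ 3} {+ 9} p∤3 (p∤-* {+ 3} {+ 3} p∤3 p∤3))

  -- 4(a³ - a′³) + 27(b² - b′²) at b′ = b - s: up to the unit -16 it is Δ(a,b) - Δ(a′,b′), and it is linear in b.
  collision : ℕ → ℕ → ℤ → ℤ → ℤ
  collision a a′ b s = + 4 * ((+ a) ^ 3 - (+ a′) ^ 3) + + 27 * (+ 2 * b * s - s * s)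

  Δ≈Δ⇒collision : ∀ a a′ b b′ → Δ (+ a) (+ b) ≈ Δ (+ a′) (+ b′) → p∣ (collision a a′ (+ b) (+ b - + b′))
  Δ≈Δ⇒collision a a′ b b′ (mk≈ h) = subst p∣_ (factor ((+ a) ^ 3 - (+ a′) ^ 3) (+ b) (+ b′)) (p∣-*-cancelˡ p∤-16 (subst p∣_ (difference (+ a) (+ a′) (+ b) (+ b′)) h))
    where
    difference : ∀ a a′ b b′ →
      - + 16 * (+ 4 * (a * (a * (a * 1ℤ))) + + 27 * (b * (b * 1ℤ))) - - + 16 * (+ 4 * (a′ * (a′ * (a′ * 1ℤ))) + + 27 * (b′ * (b′ * 1ℤ)))
        ≡ - + 16 * (+ 4 * (a * (a * (a * 1ℤ)) - a′ * (a′ * (a′ * 1ℤ))) + + 27 * (b * b - b′ * b′))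
    difference = solve-∀
    factor : ∀ A b b′ → + 4 * A + + 27 * (b * b - b′ * b′) ≡ + 4 * A + + 27 * (+ 2 * b * (b - b′) - (b - b′) * (b - b′))
    factor = solve-∀

  collision-cong : ∀ a a′ b {s t} → s ≈ t → collision a a′ b s ≈ collision a a′ b t
  collision-cong a a′ b s≈t =
    ≈-+ (≈-refl {+ 4 * ((+ a) ^ 3 - (+ a′) ^ 3)}) (≈-* (≈-refl {+ 27}) (≈-- (≈-* (≈-refl {+ 2 * b}) s≈t) (≈-* s≈t s≈t)))

  #Δ-collisions≤#shifts : ∀ a a′ b →
    # p (λ b′ → Δ (+ a) (+ b) ≈? Δ (+ a′) (+ b′)) ℕ.≤ # p (λ s → p∣? (collision a a′ (+ b) (+ s)))
  #Δ-collisions≤#shifts a a′ b = #-≤-injection p p _ _ shift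
    (λ b′ _ Δ≈Δ → rep<p (+ b - + b′) , p∣-≈ (Δ≈Δ⇒collision a a′ b b′ Δ≈Δ) (collision-cong a a′ (+ b) (rep≈ (+ b - + b′))))
    (λ i j i<p j<p _ _ eq → sym (+-injective-≈ j<p i<p (mk≈ (subst p∣_ (cancel (+ b) (+ i) (+ j))
      (p∣x-y (≈-trans (rep≈ (+ b - + i)) (≈-trans (≈-reflexive (cong +_ eq)) (≈-sym (rep≈ (+ b - + j))))))))))
    where
    shift : ℕ → ℕ
    shift b′ = rep (+ b - + b′)
    cancel : ∀ b i j → (b - i) - (b - j) ≡ j - i
    cancel = solve-∀

  #collision[s=0] : ∀ a a′ → # p (λ b → p∣? (collision a a′ (+ b) 0ℤ)) ≡ p ℕ.* χ ((+ a) ^ 3 ≈? (+ a′) ^ 3)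
  #collision[s=0] a a′ = trans
    (∑-cong p (λ b _ → χ-cong (p∣? (collision a a′ (+ b) 0ℤ)) ((+ a) ^ 3 ≈? (+ a′) ^ 3)
      (λ p∣c → mk≈ (p∣-*-cancelˡ p∤4 (subst p∣_ (s=0 _ (+ b)) p∣c)))
      (λ a³≈a′³ → subst p∣_ (sym (s=0 _ (+ b))) (p∣-*ˡ (+ 4) (p∣x-y a³≈a′³)))))
    (∑-const p _)
    where
    s=0 : ∀ X b → + 4 * X + + 27 * (+ 2 * b * 0ℤ - 0ℤ * 0ℤ) ≡ + 4 * X
    s=0 = solve-∀

  #collision[s≠0]≤1 : ∀ a a′ s → suc s ℕ.< p → # p (λ b → p∣? (collision a a′ (+ b) (+ suc s))) ℕ.≤ 1
  #collision[s≠0]≤1 a a′ s s<p = #≤1 p _ (λ i j i<p j<p p∣cᵢ p∣cⱼ → +-injective-≈ i<p j<p (mk≈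
    (p∣-*-cancelˡ (p∤-* p∤54 (p∤[+n] z<s s<p)) (subst p∣_ (linear ((+ a) ^ 3 - (+ a′) ^ 3) (+ i) (+ j) (+ suc s)) (p∣-- p∣cᵢ p∣cⱼ)))))
    where
    linear : ∀ A i j s → (+ 4 * A + + 27 * (+ 2 * i * s - s * s)) - (+ 4 * A + + 27 * (+ 2 * j * s - s * s))
        ≡ (+ 54 * s) * (i - j)
    linear = solve-∀

  Δ-collisions : ℕ → ℕ → ℕ
  Δ-collisions a a′ = ∑[ b < p ] ∑[ b′ < p ] χ (Δ (+ a) (+ b) ≈? Δ (+ a′) (+ b′))

  Δ-collisions≤ : ∀ a a′ → Δ-collisions a a′ ℕ.≤ p ℕ.* χ ((+ a) ^ 3 ≈? (+ a′) ^ 3) ℕ.+ p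
  Δ-collisions≤ a a′ = begin
    Δ-collisions a a′                                                 ≤⟨ ∑-mono-≤ p (λ b _ → #Δ-collisions≤#shifts a a′ b) ⟩
    ∑[ b < p ] ∑[ s < p ] χ (p∣? (collision a a′ (+ b) (+ s)))         ≡⟨ ∑-swap p p _ ⟩
    ∑[ s < p ] # p (λ b → p∣? (collision a a′ (+ b) (+ s)))            ≡⟨ ∑-pred p _ ⟩
    # p (λ b → p∣? (collision a a′ (+ b) 0ℤ)) ℕ.+
      ∑[ s < ℕ.pred p ] # p (λ b → p∣? (collision a a′ (+ b) (+ suc s))) ≤⟨ ℕ.+-mono-≤ (ℕ.≤-reflexive (#collision[s=0] a a′))
                                                                            (∑-mono-≤ (ℕ.pred p) (λ s s<p-1 →
                                                                              #collision[s≠0]≤1 a a′ s (s+1<p s<p-1))) ⟩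
    p ℕ.* χ ((+ a) ^ 3 ≈? (+ a′) ^ 3) ℕ.+ ∑[ s < ℕ.pred p ] 1          ≡⟨ cong (p ℕ.* χ ((+ a) ^ 3 ≈? (+ a′) ^ 3) ℕ.+_)
                                                                            (trans (∑-const (ℕ.pred p) 1) (ℕ.*-identityʳ (ℕ.pred p))) ⟩
    p ℕ.* χ ((+ a) ^ 3 ≈? (+ a′) ^ 3) ℕ.+ ℕ.pred p                     ≤⟨ ℕ.+-monoʳ-≤ (p ℕ.* χ ((+ a) ^ 3 ≈? (+ a′) ^ 3)) ℕ.pred[n]≤n ⟩
    p ℕ.* χ ((+ a) ^ 3 ≈? (+ a′) ^ 3) ℕ.+ p                            ∎
    where
    open ℕ.≤-Reasoning
    s+1<p : ∀ {s} → s ℕ.< ℕ.pred p → suc s ℕ.< p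
    s+1<p s<p-1 = subst (suc _ ℕ.<_) (ℕ.suc-pred p) (s<s s<p-1)

  #cube-roots≤3 : ∀ a → # p (λ a′ → (+ a) ^ 3 ≈? (+ a′) ^ 3) ℕ.≤ 3
  #cube-roots≤3 a = ℕ.≤-trans
    (ℕ.≤-reflexive (#-cong p _ _ (λ a′ _ h → ≈-trans (≈-reflexive (ℤ.*-identityˡ _)) (≈-sym h))
                                 (λ a′ _ h → ≈-sym (≈-trans (≈-reflexive (sym (ℤ.*-identityˡ _))) h))))
    (#-solutions-a*xⁿ≈b 3 (s≤s z≤n) ((+ a) ^ 3) p∤1)

  ∑-fibre₂²≤ : ∑[ y < p ] (fibre₂ y ℕ.* fibre₂ y) ℕ.≤ p ℕ.* p ℕ.* p ℕ.+ 3 ℕ.* (p ℕ.* p)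
  ∑-fibre₂²≤ = begin
    ∑[ y < p ] (fibre₂ y ℕ.* fibre₂ y)                              ≡⟨ ∑-fibre₂² ⟩
    ∑[ a < p ] ∑[ b < p ] ∑[ a′ < p ] ∑[ b′ < p ] χ (Δ (+ a) (+ b) ≈? Δ (+ a′) (+ b′))
                                                                    ≡⟨ ∑-cong p (λ a _ → ∑-swap p p _) ⟩
    ∑[ a < p ] ∑[ a′ < p ] Δ-collisions a a′                        ≤⟨ ∑-mono-≤ p (λ a _ → ∑-mono-≤ p (λ a′ _ → Δ-collisions≤ a a′)) ⟩
    ∑[ a < p ] ∑[ a′ < p ] (p ℕ.* χ ((+ a) ^ 3 ≈? (+ a′) ^ 3) ℕ.+ p) ≡⟨ ∑-cong p (λ a _ → trans (∑-distrib-+ p _ _)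
                                                                          (cong₂ ℕ._+_ (sym (*-distribˡ-∑ p p _)) (∑-const p p))) ⟩
    ∑[ a < p ] (p ℕ.* # p (λ a′ → (+ a) ^ 3 ≈? (+ a′) ^ 3) ℕ.+ p ℕ.* p)
                                                                    ≤⟨ ∑-mono-≤ p (λ a _ → ℕ.+-monoˡ-≤ (p ℕ.* p) (ℕ.*-monoʳ-≤ p (#cube-roots≤3 a))) ⟩
    ∑[ a < p ] (p ℕ.* 3 ℕ.+ p ℕ.* p)                                ≡⟨ ∑-const p _ ⟩
    p ℕ.* (p ℕ.* 3 ℕ.+ p ℕ.* p)                                     ≡⟨ rearrange p ⟩
    p ℕ.* p ℕ.* p ℕ.+ 3 ℕ.* (p ℕ.* p)                               ∎
    where
    open ℕ.≤-Reasoning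
    rearrange : ∀ p → p ℕ.* (p ℕ.* 3 ℕ.+ p ℕ.* p) ≡ p ℕ.* p ℕ.* p ℕ.+ 3 ℕ.* (p ℕ.* p)
    rearrange = ℕ-Solver.solve-∀

module SecondMoment where

  open import Data.Nat
  open import Data.Nat.Properties
  open import Data.Nat.Tactic.RingSolver using (solve-∀)
  open import Data.Sum using (inj₁; inj₂)
  open import Function using (_∘_)
  open import Relation.Binary.PropositionalEquality
  open FiniteSum

  ∣m-n∣²+2mn≡m²+n²-≤ : ∀ {m n} → m ≤ n → ∣ m - n ∣ * ∣ m - n ∣ + 2 * (m * n) ≡ m * m + n * n
  ∣m-n∣²+2mn≡m²+n²-≤ {m} {n} m≤n = subst (λ k → ∣ m - k ∣ * ∣ m - k ∣ + 2 * (m * k) ≡ m * m + k * k) (m+[n∸m]≡n m≤n)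
    (trans (cong (λ d → d * d + 2 * (m * (m + (n ∸ m)))) (∣m-m+n∣≡n m (n ∸ m))) (expand m (n ∸ m)))
    where
    expand : ∀ m d → d * d + 2 * (m * (m + d)) ≡ m * m + (m + d) * (m + d)
    expand = solve-∀

  ∣m-n∣²+2mn≡m²+n² : ∀ m n → ∣ m - n ∣ * ∣ m - n ∣ + 2 * (m * n) ≡ m * m + n * n
  ∣m-n∣²+2mn≡m²+n² m n with ≤-total m n
  ... | inj₁ m≤n = ∣m-n∣²+2mn≡m²+n²-≤ m≤n
  ... | inj₂ n≤m = subst₂ _≡_ (cong₂ _+_ (cong₂ _*_ (∣-∣-comm n m) (∣-∣-comm n m)) (cong (2 *_) (*-comm n m)))
    (+-comm (n * n) (m * m)) (∣m-n∣²+2mn≡m²+n²-≤ n≤m)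

  [m+n]²≤2[m²+n²] : ∀ m n → (m + n) * (m + n) ≤ 2 * (m * m + n * n)
  [m+n]²≤2[m²+n²] m n = begin
    (m + n) * (m + n)                                ≡⟨ expand m n ⟩
    (m * m + n * n) + 2 * (m * n)                    ≤⟨ m≤n+m ((m * m + n * n) + 2 * (m * n)) (∣ m - n ∣ * ∣ m - n ∣) ⟩
    ∣ m - n ∣ * ∣ m - n ∣ + ((m * m + n * n) + 2 * (m * n))
                                                     ≡⟨ regroup (∣ m - n ∣ * ∣ m - n ∣) (m * m + n * n) (2 * (m * n)) ⟩
    (m * m + n * n) + (∣ m - n ∣ * ∣ m - n ∣ + 2 * (m * n))
                                                     ≡⟨ cong ((m * m + n * n) +_) (∣m-n∣²+2mn≡m²+n² m n) ⟩
    (m * m + n * n) + (m * m + n * n)                ≡⟨ cong ((m * m + n * n) +_) (+-identityʳ _) ⟨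
    2 * (m * m + n * n)                              ∎
    where
    open ≤-Reasoning
    expand : ∀ m n → (m + n) * (m + n) ≡ (m * m + n * n) + 2 * (m * n)
    expand = solve-∀
    regroup : ∀ d s t → d + (s + t) ≡ s + (d + t)
    regroup = solve-∀

  ∣m+n-o+p∣≤∣m-o∣+∣n-p∣ : ∀ m n o p → ∣ m + n - o + p ∣ ≤ ∣ m - o ∣ + ∣ n - p ∣
  ∣m+n-o+p∣≤∣m-o∣+∣n-p∣ m n o p = begin
    ∣ m + n - o + p ∣                   ≤⟨ ∣-∣-triangle (m + n) (o + n) (o + p) ⟩
    ∣ m + n - o + n ∣ + ∣ o + n - o + p ∣ ≡⟨ cong₂ _+_ (trans (cong₂ ∣_-_∣ (+-comm m n) (+-comm o n)) (∣m+n-m+o∣≡∣n-o∣ n m o))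
                                                      (∣m+n-m+o∣≡∣n-o∣ o n p) ⟩
    ∣ m - o ∣ + ∣ n - p ∣                 ∎
    where open ≤-Reasoning

  ∣∑f-∑g∣≤∑∣f-g∣ : ∀ n (f g : ℕ → ℕ) → ∣ ∑ n f - ∑ n g ∣ ≤ ∑[ i < n ] ∣ f i - g i ∣
  ∣∑f-∑g∣≤∑∣f-g∣ zero    f g = z≤n
  ∣∑f-∑g∣≤∑∣f-g∣ (suc n) f g = ≤-trans (∣m+n-o+p∣≤∣m-o∣+∣n-p∣ (f 0) _ (g 0) _)
    (+-monoʳ-≤ ∣ f 0 - g 0 ∣ (∣∑f-∑g∣≤∑∣f-g∣ n (f ∘ suc) (g ∘ suc)))

  2xA≤B+Wx² : ∀ W A B x → A * A ≤ W * B → 2 * x * A ≤ B + W * (x * x)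
  2xA≤B+Wx² zero    zero    B x _ = subst (_≤ B + 0) (sym (*-zeroʳ (2 * x))) z≤n
  2xA≤B+Wx² zero    (suc A) B x ()
  2xA≤B+Wx² (suc w) A       B x A²≤WB = *-cancelˡ-≤ (suc w) (begin
    suc w * (2 * x * A)                         ≡⟨ shuffle (suc w) x A ⟩
    2 * (suc w * x) * A                         ≤⟨ 2mn≤m²+n² (suc w * x) A ⟩
    (suc w * x) * (suc w * x) + A * A           ≤⟨ +-monoʳ-≤ ((suc w * x) * (suc w * x)) A²≤WB ⟩
    (suc w * x) * (suc w * x) + suc w * B       ≡⟨ factor (suc w) x B ⟩
    suc w * (B + suc w * (x * x))               ∎)
    where
    open ≤-Reasoning
    2mn≤m²+n² : ∀ m n → 2 * m * n ≤ m * m + n * n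
    2mn≤m²+n² m n = subst (_≤ m * m + n * n) (sym (*-assoc 2 m n))
      (subst (2 * (m * n) ≤_) (∣m-n∣²+2mn≡m²+n² m n) (m≤n+m (2 * (m * n)) (∣ m - n ∣ * ∣ m - n ∣)))
    shuffle : ∀ W x A → W * (2 * x * A) ≡ 2 * (W * x) * A
    shuffle = solve-∀
    factor : ∀ W x B → (W * x) * (W * x) + W * B ≡ W * (B + W * (x * x))
    factor = solve-∀

  cauchy-schwarz : ∀ n (w e : ℕ → ℕ) →
    (∑[ i < n ] (w i * e i)) * (∑[ i < n ] (w i * e i)) ≤ ∑ n w * ∑[ i < n ] (w i * (e i * e i))
  cauchy-schwarz zero    w e = z≤n
  cauchy-schwarz (suc n) w e = begin
    (a * x + A) * (a * x + A)                                ≡⟨ expand a x A ⟩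
    a * (a * (x * x)) + a * (2 * x * A) + A * A              ≤⟨ +-mono-≤ (+-monoʳ-≤ (a * (a * (x * x))) (*-monoʳ-≤ a (2xA≤B+Wx² W A B x ih))) ih ⟩
    a * (a * (x * x)) + a * (B + W * (x * x)) + W * B        ≡⟨ factor a x W B ⟩
    (a + W) * (a * (x * x) + B)                              ∎
    where
    open ≤-Reasoning
    a = w 0
    x = e 0
    A = ∑[ i < n ] (w (suc i) * e (suc i))
    W = ∑ n (w ∘ suc)
    B = ∑[ i < n ] (w (suc i) * (e (suc i) * e (suc i)))
    ih = cauchy-schwarz n (w ∘ suc) (e ∘ suc)
    expand : ∀ a x A → (a * x + A) * (a * x + A) ≡ a * (a * (x * x)) + a * (2 * x * A) + A * A
    expand = solve-∀
    factor : ∀ a x W B → a * (a * (x * x)) + a * (B + W * (x * x)) + W * B ≡ (a + W) * (a * (x * x) + B)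
    factor = solve-∀

  ∑∣f-μ∣²+2μ∑f≡∑f²+nμ² : ∀ n (f : ℕ → ℕ) μ →
    ∑[ i < n ] (∣ f i - μ ∣ * ∣ f i - μ ∣) + 2 * (∑ n f * μ) ≡ ∑[ i < n ] (f i * f i) + n * (μ * μ)
  ∑∣f-μ∣²+2μ∑f≡∑f²+nμ² n f μ = begin
    V + 2 * (∑ n f * μ)                                ≡⟨ cong (λ t → V + 2 * t) (*-distribʳ-∑ n μ f) ⟩
    V + 2 * ∑[ i < n ] (f i * μ)                       ≡⟨ cong (V +_) (*-distribˡ-∑ n 2 (λ i → f i * μ)) ⟩
    V + ∑[ i < n ] (2 * (f i * μ))                     ≡⟨ ∑-distrib-+ n _ _ ⟨
    ∑[ i < n ] (∣ f i - μ ∣ * ∣ f i - μ ∣ + 2 * (f i * μ)) ≡⟨ ∑-cong n (λ i _ → ∣m-n∣²+2mn≡m²+n² (f i) μ) ⟩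
    ∑[ i < n ] (f i * f i + μ * μ)                     ≡⟨ ∑-distrib-+ n _ _ ⟩
    ∑[ i < n ] (f i * f i) + ∑[ i < n ] (μ * μ)        ≡⟨ cong (∑[ i < n ] (f i * f i) +_) (∑-const n (μ * μ)) ⟩
    ∑[ i < n ] (f i * f i) + n * (μ * μ)               ∎
    where
    open ≡-Reasoning
    V = ∑[ i < n ] (∣ f i - μ ∣ * ∣ f i - μ ∣)

  subset-deviation : ∀ n (w f : ℕ → ℕ) μ → (∀ i → w i ≤ 1) →
    ∣ ∑[ i < n ] (w i * f i) - ∑ n w * μ ∣ * ∣ ∑[ i < n ] (w i * f i) - ∑ n w * μ ∣
      ≤ ∑ n w * ∑[ i < n ] (∣ f i - μ ∣ * ∣ f i - μ ∣)
  subset-deviation n w f μ w≤1 = begin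
    D * D                                                       ≤⟨ *-mono-≤ D≤ D≤ ⟩
    (∑[ i < n ] (w i * e i)) * (∑[ i < n ] (w i * e i))         ≤⟨ cauchy-schwarz n w e ⟩
    ∑ n w * ∑[ i < n ] (w i * (e i * e i))                      ≤⟨ *-monoʳ-≤ (∑ n w) (∑-mono-≤ n (λ i _ → weight≤1 i)) ⟩
    ∑ n w * ∑[ i < n ] (e i * e i)                              ∎
    where
    open ≤-Reasoning
    e = λ i → ∣ f i - μ ∣
    D = ∣ ∑[ i < n ] (w i * f i) - ∑ n w * μ ∣
    D≤ : D ≤ ∑[ i < n ] (w i * e i)
    D≤ = begin
      D                                           ≡⟨ cong (λ t → ∣ ∑[ i < n ] (w i * f i) - t ∣) (*-distribʳ-∑ n μ w) ⟩
      ∣ ∑[ i < n ] (w i * f i) - ∑[ i < n ] (w i * μ) ∣ ≤⟨ ∣∑f-∑g∣≤∑∣f-g∣ n _ _ ⟩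
      ∑[ i < n ] ∣ w i * f i - w i * μ ∣          ≡⟨ ∑-cong n (λ i _ → sym (*-distribˡ-∣-∣ (w i) (f i) μ)) ⟩
      ∑[ i < n ] (w i * e i)                      ∎
    weight≤1 : ∀ i → w i * (e i * e i) ≤ e i * e i
    weight≤1 i = ≤-trans (*-monoˡ-≤ (e i * e i) (w≤1 i)) (≤-reflexive (*-identityˡ (e i * e i)))

open import Data.Nat as ℕ using (ℕ; suc; z≤n; s≤s; z<s; _≤_; _<_; _^_; _∸_; _*_; _+_; ∣_-_∣)
import Data.Nat.Properties as ℕ
open import Data.Nat.Divisibility using (_∣_; divides)
open import Data.Nat.Primality using (Prime)
open import Data.Nat.Tactic.RingSolver using (solve-∀)
open import Data.Integer as ℤ using (+_)
import Data.Integer.Properties as ℤ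
open import Data.List.Membership.Propositional using (find; lose)
open import Data.List.Membership.Propositional.Properties using (∈-upTo⁺; ∈-upTo⁻)
open import Data.Product using (Σ; _,_)
open import Data.Sum using (inj₁; inj₂)
open import Relation.Nullary using (¬_)
open import Relation.Binary.PropositionalEquality
open import Defs
open FiniteSum
open SecondMoment

∣[+m]-[+n]∣≡∣m-n∣ : ∀ m n → ℤ.∣ + m ℤ.- + n ∣ ≡ ∣ m - n ∣
∣[+m]-[+n]∣≡∣m-n∣ m n with ℕ.≤-total m n
... | inj₁ m≤n = trans (cong ℤ.∣_∣ (ℤ.[+m]-[+n]≡m⊖n m n)) (trans (ℤ.∣⊖∣-≤ m≤n) (sym (ℕ.m≤n⇒∣m-n∣≡n∸m m≤n)))
... | inj₂ n≤m = trans (cong ℤ.∣_∣ (ℤ.[+m]-[+n]≡m⊖n m n))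
  (trans (ℤ.∣m⊖n∣≡∣n⊖m∣ m n) (trans (ℤ.∣⊖∣-≤ n≤m) (sym (ℕ.m≤n⇒∣n-m∣≡n∸m n≤m))))

E²≤8r²p³ : ∀ r p D E → 1 ≤ p → E ≤ r * D + r * p → D * D ≤ 3 * (p * p * p) → E * E ≤ 8 * r * r * (p * p * p)
E²≤8r²p³ r p D E 1≤p E≤ D²≤ = begin
  E * E                                         ≤⟨ ℕ.*-mono-≤ E≤ E≤ ⟩
  (r * D + r * p) * (r * D + r * p)             ≤⟨ [m+n]²≤2[m²+n²] (r * D) (r * p) ⟩
  2 * (r * D * (r * D) + r * p * (r * p))       ≡⟨ factor r D p ⟩
  2 * (r * r) * (D * D + p * p)                 ≤⟨ ℕ.*-monoʳ-≤ (2 * (r * r)) (ℕ.+-mono-≤ D²≤ p²≤p³) ⟩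
  2 * (r * r) * (3 * (p * p * p) + p * p * p)   ≡⟨ collect r p ⟩
  8 * r * r * (p * p * p)                       ∎
  where
  open ℕ.≤-Reasoning
  p²≤p³ : p * p ≤ p * p * p
  p²≤p³ = ℕ.m≤m*n (p * p) p {{ℕ.>-nonZero 1≤p}}
  factor : ∀ r D p → 2 * (r * D * (r * D) + r * p * (r * p)) ≡ 2 * (r * r) * (D * D + p * p)
  factor = solve-∀
  collect : ∀ r p → 2 * (r * r) * (3 * (p * p * p) + p * p * p) ≡ 8 * r * r * (p * p * p)
  collect = solve-∀

module CountBound (r : ℕ) (r≥1 : 1 ≤ r) (p : ℕ) (p-prime : Prime p) (p∤6 : ¬ p ∣ 6)
             (m : ℕ) (p-1≡m*r : ℕ.pred p ≡ m * r) (γ : ℕ) (0<γ : 0 < γ) (γ<p : γ < p) where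

  open ModPrime p p-prime
  open DiscriminantFibres p p-prime p∤6
  open PowerValues p p-prime (+ γ) r r≥1

  χ-image : ℕ → ℕ
  χ-image y = χ (InImage? y)

  Good⇔InImage : ∀ a b → χ (Good? p r γ (a , b)) ≡ χ-image (rep (Δ (+ a) (+ b)))
  Good⇔InImage a b = χ-cong (Good? p r γ (a , b)) (InImage? (rep (Δ (+ a) (+ b)))) good⇒ ⇒good
    where
    good⇒ : Good p r γ (a , b) → InImage (rep (Δ (+ a) (+ b)))
    good⇒ good with find good
    ... | c , c∈ , Δ≡γcʳ = c , ∈-upTo⁻ c∈ , ≈-trans (≈-sym (rep≈ (Δ (+ a) (+ b)))) (≡mod⇒≈ Δ≡γcʳ)
    ⇒good : InImage (rep (Δ (+ a) (+ b))) → Good p r γ (a , b)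
    ⇒good (c , c<p , Δ≈γcʳ) = lose (∈-upTo⁺ c<p) (≈⇒≡mod (≈-trans (rep≈ (Δ (+ a) (+ b))) Δ≈γcʳ))

  count≡∑χ-image*fibre₂ : count p r γ ≡ ∑[ y < p ] (χ-image y * fibre₂ y)
  count≡∑χ-image*fibre₂ = begin
    count p r γ                                                             ≡⟨ length-filter-upTo² (Good? p r γ) p ⟩
    ∑[ a < p ] ∑[ b < p ] χ (Good? p r γ (a , b))                           ≡⟨ ∑-cong p (λ a _ → ∑-cong p (λ b _ →
                                                                                 trans (Good⇔InImage a b) (sym (∑-representative _ χ-image)))) ⟩
    ∑[ a < p ] ∑[ b < p ] ∑[ y < p ] (χ (+ y ≈? Δ (+ a) (+ b)) * χ-image y) ≡⟨ ∑-cong p (λ a _ → ∑-swap p p _) ⟩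
    ∑[ a < p ] ∑[ y < p ] ∑[ b < p ] (χ (+ y ≈? Δ (+ a) (+ b)) * χ-image y) ≡⟨ ∑-swap p p _ ⟩
    ∑[ y < p ] ∑[ a < p ] ∑[ b < p ] (χ (+ y ≈? Δ (+ a) (+ b)) * χ-image y) ≡⟨ ∑-cong p (λ y _ → factor-out y) ⟩
    ∑[ y < p ] (χ-image y * fibre₂ y)                                       ∎
    where
    open ≡-Reasoning
    factor-out : ∀ y → ∑[ a < p ] ∑[ b < p ] (χ (+ y ≈? Δ (+ a) (+ b)) * χ-image y) ≡ χ-image y * fibre₂ y
    factor-out y = trans (∑-cong p (λ a _ → sym (*-distribʳ-∑ p (χ-image y) _)))
      (trans (sym (*-distribʳ-∑ p (χ-image y) _)) (ℕ.*-comm (fibre₂ y) (χ-image y)))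

  ∑∣fibre₂-p∣²≤3p² : ∑[ y < p ] (∣ fibre₂ y - p ∣ * ∣ fibre₂ y - p ∣) ≤ 3 * (p * p)
  ∑∣fibre₂-p∣²≤3p² = ℕ.+-cancelʳ-≤ (2 * (p * p * p)) _ _ (begin
    V + 2 * (p * p * p)                            ≡⟨ cong (λ t → V + 2 * (t * p)) (sym ∑-fibre₂) ⟩
    V + 2 * (∑ p fibre₂ * p)                       ≡⟨ ∑∣f-μ∣²+2μ∑f≡∑f²+nμ² p fibre₂ p ⟩
    ∑[ y < p ] (fibre₂ y * fibre₂ y) + p * (p * p) ≤⟨ ℕ.+-monoˡ-≤ (p * (p * p)) ∑-fibre₂²≤ ⟩
    p * p * p + 3 * (p * p) + p * (p * p)          ≡⟨ rearrange p ⟩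
    3 * (p * p) + 2 * (p * p * p)                  ∎)
    where
    open ℕ.≤-Reasoning
    V = ∑[ y < p ] (∣ fibre₂ y - p ∣ * ∣ fibre₂ y - p ∣)
    rearrange : ∀ p → p * p * p + 3 * (p * p) + p * (p * p) ≡ 3 * (p * p) + 2 * (p * p * p)
    rearrange = solve-∀

  #image≤p : # p InImage? ≤ p
  #image≤p = ℕ.≤-trans (∑-mono-≤ p (λ y _ → χ≤1 (InImage? y))) (ℕ.≤-reflexive (trans (∑-const p 1) (ℕ.*-identityʳ p)))

  ∣count-[1+m]p∣²≤3p³ : ∣ count p r γ - suc m * p ∣ * ∣ count p r γ - suc m * p ∣ ≤ 3 * (p * p * p)
  ∣count-[1+m]p∣²≤3p³ = begin
    ∣ count p r γ - suc m * p ∣ * ∣ count p r γ - suc m * p ∣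
      ≡⟨ cong (λ t → ∣ count p r γ - t * p ∣ * ∣ count p r γ - t * p ∣) (sym (#image≡1+m p∤γ m p-1≡m*r)) ⟩
    ∣ count p r γ - # p InImage? * p ∣ * ∣ count p r γ - # p InImage? * p ∣
      ≡⟨ cong (λ t → ∣ t - # p InImage? * p ∣ * ∣ t - # p InImage? * p ∣) count≡∑χ-image*fibre₂ ⟩
    ∣ ∑[ y < p ] (χ-image y * fibre₂ y) - # p InImage? * p ∣ * ∣ ∑[ y < p ] (χ-image y * fibre₂ y) - # p InImage? * p ∣
      ≤⟨ subset-deviation p χ-image fibre₂ p (λ y → χ≤1 (InImage? y)) ⟩
    # p InImage? * ∑[ y < p ] (∣ fibre₂ y - p ∣ * ∣ fibre₂ y - p ∣)
      ≤⟨ ℕ.*-mono-≤ #image≤p ∑∣fibre₂-p∣²≤3p² ⟩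
    p * (3 * (p * p))
      ≡⟨ rearrange p ⟩
    3 * (p * p * p) ∎
    where
    open ℕ.≤-Reasoning
    p∤γ = p∤[+n] 0<γ γ<p
    rearrange : ∀ p → p * (3 * (p * p)) ≡ 3 * (p * p * p)
    rearrange = solve-∀

  ∣r*count-p²∣≤ : ∣ r * count p r γ - p * p ∣ ≤ r * ∣ count p r γ - suc m * p ∣ + r * p
  ∣r*count-p²∣≤ = begin
    ∣ r * X - p * p ∣                                 ≤⟨ ℕ.∣-∣-triangle (r * X) (r * (suc m * p)) (p * p) ⟩
    ∣ r * X - r * (suc m * p) ∣ + ∣ r * (suc m * p) - p * p ∣
                                                      ≡⟨ cong₂ _+_ (sym (ℕ.*-distribˡ-∣-∣ r X (suc m * p)))
                                                                   (cong (λ t → ∣ t - p * p ∣) r[1+m]p≡p²+[r-1]p) ⟩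
    r * ∣ X - suc m * p ∣ + ∣ p * p + (r ∸ 1) * p - p * p ∣
                                                      ≡⟨ cong (λ t → r * ∣ X - suc m * p ∣ + t)
                                                              (trans (ℕ.∣-∣-comm (p * p + (r ∸ 1) * p) (p * p)) (ℕ.∣m-m+n∣≡n (p * p) _)) ⟩
    r * ∣ X - suc m * p ∣ + (r ∸ 1) * p               ≤⟨ ℕ.+-monoʳ-≤ (r * ∣ X - suc m * p ∣) (ℕ.*-monoˡ-≤ p (ℕ.m∸n≤m r 1)) ⟩
    r * ∣ X - suc m * p ∣ + r * p                     ∎
    where
    open ℕ.≤-Reasoning
    X = count p r γ
    r[1+m]p≡p²+[r-1]p : r * (suc m * p) ≡ p * p + (r ∸ 1) * p
    r[1+m]p≡p²+[r-1]p = subst (λ q → r * (suc m * q) ≡ q * q + (r ∸ 1) * q) (ℕ.suc-pred p {{nonZero}})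
                                (scale r r≥1 (ℕ.pred p) p-1≡m*r)
      where
      nonZero = ℕ.>-nonZero (ℕ.<-trans z<s 1<p)
      scale : ∀ r → 1 ≤ r → ∀ p′ → p′ ≡ m * r → r * (suc m * suc p′) ≡ suc p′ * suc p′ + (r ∸ 1) * suc p′
      scale (suc r′) _ .(m * suc r′) refl = expand r′ m
        where
        expand : ∀ r′ m → suc r′ * (suc m * suc (m * suc r′)) ≡ suc (m * suc r′) * suc (m * suc r′) + r′ * suc (m * suc r′)
        expand = solve-∀

  ∣r*count-p²∣²≤8r²p³ : ∣ r * count p r γ - p * p ∣ * ∣ r * count p r γ - p * p ∣ ≤ 8 * r * r * (p * p * p)
  ∣r*count-p²∣²≤8r²p³ = E²≤8r²p³ r p _ _ (ℕ.<-trans z<s 1<p) ∣r*count-p²∣≤ ∣count-[1+m]p∣²≤3p³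

lemma6p5 : (r : ℕ) → 2 ≤ r →
    Σ ℕ λ C → (p : ℕ) → Prime p → ¬ (p ∣ 6) → r ∣ p ∸ 1 →
      (γ : ℕ) → 0 < γ → γ < p →
        ℤ.∣ (+ (r * count p r γ)) ℤ.- (+ (p ^ 2)) ∣ ^ 2 ≤ C * p ^ 3
lemma6p5 r r≥2 = 8 * r * r , λ p p-prime p∤6 (divides m p-1≡m*r) γ 0<γ γ<p → begin
  ℤ.∣ + (r * count p r γ) ℤ.- + (p ^ 2) ∣ ^ 2     ≡⟨ cong (_^ 2) (∣[+m]-[+n]∣≡∣m-n∣ (r * count p r γ) (p ^ 2)) ⟩
  ∣ r * count p r γ - p ^ 2 ∣ ^ 2                 ≡⟨ cong (λ t → ∣ r * count p r γ - t ∣ ^ 2) (n²≡n*n p) ⟩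
  ∣ r * count p r γ - p * p ∣ ^ 2                 ≡⟨ n²≡n*n ∣ r * count p r γ - p * p ∣ ⟩
  ∣ r * count p r γ - p * p ∣ * ∣ r * count p r γ - p * p ∣
                                                  ≤⟨ CountBound.∣r*count-p²∣²≤8r²p³ r (ℕ.≤-trans (s≤s z≤n) r≥2) p p-prime p∤6 m p-1≡m*r γ 0<γ γ<p ⟩
  8 * r * r * (p * p * p)                         ≡⟨ cong (8 * r * r *_) (n*n*n≡n³ p) ⟩
  8 * r * r * p ^ 3                               ∎
  where
  open ℕ.≤-Reasoning
  n²≡n*n : ∀ n → n ^ 2 ≡ n * n
  n²≡n*n n = cong (n *_) (ℕ.*-identityʳ n)
  n*n*n≡n³ : ∀ n → n * n * n ≡ n ^ 3
  n*n*n≡n³ n = trans (ℕ.*-assoc n n n) (cong (n *_) (sym (n²≡n*n n)))
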